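{- Let $q$ be a power of an odd prime with $q-1=2^s r$, $r$ odd, let $a\in\mathbb{F}_q^*\setminus\{1,-1\}$ with $\chi_2(1-a^2)=1$, and let $f:\mathbb{F}_{q^2}\to\mathbb{F}_{q^2}$, $f(X)=X^{q+1}+aX^2$. Then the union of the connected components of the functional graph of $f$ that contain elements of $\mathbb{F}_q$ is isomorphic to the graph obtained from the functional graph of $f|_{\mathbb{F}_q}:\mathbb{F}_q\to\mathbb{F}_q$, $x\mapsto(a+1)x^2$, by attaching, to every $\alpha\in\mathbb{F}_q$ with $\chi_2(\alpha(a-1))=-1$, two new vertices each with an edge directed to $\alpha$ (and no incoming edges). In particular, $0$ is a fixed point whose connected component is $\{0\}$ alone, and $\frac{1}{a+1}$ is a fixed point whose connected component is isomorphic to $\mathscr{Z}^*(4)$ if $s=1$, and isomorphic to $(Cyc(1),\mathscr{T}(s+1))$ if $s\ge2$.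
   Context: $\chi_2$ is the quadratic character of $\mathbb{F}_q$ ($1$ on nonzero squares, $-1$ on non-squares, $0$ at $0$). The functional graph of a map $g$ on a finite set $S$ is the directed graph with vertices $S$ and edges $x\to g(x)$. $Cyc(1)$ is a single vertex with a loop. $\mathscr{T}(1)$ is the rooted directed tree with two vertices $P_1\to P$ (root $P$); for $m\ge1$, $\mathscr{T}(m+1)$ is obtained from $\mathscr{T}(m)$ by adding, for each vertex in the last (farthest from the root) level, two new vertices with edges directed to it. $(Cyc(1),\mathscr{T}(m))$ is the loop vertex with a copy of $\mathscr{T}(m)$ attached by identifying its root with that vertex. $\mathscr{Z}^*(4)$ is a loop vertex together with $3$ further vertices, each having an edge to the loop vertex and no incoming edges. -}

module Defs where

open import Level using (0ℓ)
open import Data.Nat as ℕ using (ℕ; zero; suc; _<_)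
open import Data.Nat.Properties using (≤-trans; n≤1+n)
open import Data.Bool using (Bool)
open import Data.Fin as Fin using (Fin)
open import Data.Fin.Properties using (any?)
open import Data.Integer as ℤ using (ℤ; +_; -[1+_])
open import Data.List using (List; []; _∷_; length)
open import Data.Maybe using (Maybe; just; nothing)
open import Data.Product using (Σ; ∃; _×_; _,_; proj₁)
open import Function using (_∘_)
open import Function.Bundles using (_↔_; _⇔_; Inverse)
open import Function.Definitions using (Injective)
open import Relation.Nullary using (¬_; Dec; yes; no)
open import Relation.Binary.PropositionalEquality using (_≡_; refl; cong; sym; trans)
import Algebra.Structures as AS

record FiniteField (q : ℕ) : Set₁ where
  infixl 6 _+_ _-_
  infixl 7 _*_
  field
    Carrier  : Set
    _+_ _*_  : Carrier → Carrier → Carrier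
    -_       : Carrier → Carrier
    0# 1#    : Carrier
    isCommutativeRing : AS.IsCommutativeRing {A = Carrier} _≡_ _+_ _*_ -_ 0# 1#
    0≢1      : ¬ (0# ≡ 1#)
    inverse  : ∀ x → ¬ (x ≡ 0#) → ∃ λ y → x * y ≡ 1#
    enumeration : Carrier ↔ Fin q

  _-_ : Carrier → Carrier → Carrier
  x - y = x + (- y)

  _^_ : Carrier → ℕ → Carrier
  x ^ zero  = 1#
  x ^ suc n = x * (x ^ n)

  _≟_ : (x y : Carrier) → Dec (x ≡ y)
  x ≟ y with Inverse.to enumeration x Fin.≟ Inverse.to enumeration y
  ... | yes p = yes (trans (sym (Inverse.strictlyInverseʳ enumeration x))
                      (trans (cong (Inverse.from enumeration) p)
                             (Inverse.strictlyInverseʳ enumeration y)))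
  ... | no ¬p = no (λ e → ¬p (cong (Inverse.to enumeration) e))

  IsSquare : Carrier → Set
  IsSquare x = ∃ λ y → y * y ≡ x

  isSquare? : (x : Carrier) → Dec (IsSquare x)
  isSquare? x with any? {P = λ i → Inverse.from enumeration i * Inverse.from enumeration i ≡ x}
                        (λ i → (Inverse.from enumeration i * Inverse.from enumeration i) ≟ x)
  ... | yes (i , p) = yes (Inverse.from enumeration i , p)
  ... | no ¬p = no λ { (y , e) → ¬p (Inverse.to enumeration y ,
         trans (cong (λ z → z * z) (Inverse.strictlyInverseʳ enumeration y)) e) }

  χ₂ : Carrier → ℤ
  χ₂ x with x ≟ 0#
  ... | yes _ = + 0
  ... | no _ with isSquare? x
  ...   | yes _ = + 1
  ...   | no _  = -[1+ 0 ]

record FieldEmbedding {q q′ : ℕ} (K : FiniteField q) (L : FiniteField q′) : Set where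
  private
    module K = FiniteField K
    module L = FiniteField L
  field
    ι    : K.Carrier → L.Carrier
    ι-+  : ∀ x y → ι (x K.+ y) ≡ ι x L.+ ι y
    ι-*  : ∀ x y → ι (x K.* y) ≡ ι x L.* ι y
    ι-1  : ι K.1# ≡ L.1#

iter : {X : Set} → (X → X) → ℕ → X → X
iter g zero    x = x
iter g (suc n) x = g (iter g n x)

SameComponent : {X : Set} → (X → X) → X → X → Set
SameComponent g x y = ∃ λ m → ∃ λ n → iter g m x ≡ iter g n y

-- The functional graph of h : V → V is isomorphic to the subgraph of the
-- functional graph of g : X → X induced on the vertex set {x | P x}:
-- an injection ψ : V → X with image exactly P, commuting with the edges.
FunGraphIso : (V : Set) (h : V → V) {X : Set} (g : X → X) (P : X → Set) → Set
FunGraphIso V h {X} g P =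
  Σ (V → X) λ ψ → Injective _≡_ _≡_ ψ
                × (∀ x → P x ⇔ (∃ λ v → ψ v ≡ x))
                × (∀ v → ψ (h v) ≡ g (ψ v))

-- Z*(4): a loop vertex (0) and three vertices pointing to it
Zstar4-V : Set
Zstar4-V = Fin 4

Zstar4-next : Zstar4-V → Zstar4-V
Zstar4-next _ = Fin.zero

-- (Cyc(1), T(m)): root = nothing (with a loop); the vertices at level j ≥ 1
-- of T(m) are binary addresses (lists of Bool) of length j - 1, j ≤ m;
-- the edge of  b ∷ l  goes to  l , and the edge of  []  (the vertex P₁) to the root.
CycTree-V : ℕ → Set
CycTree-V m = Maybe (Σ (List Bool) λ l → length l < m)

CycTree-next : (m : ℕ) → CycTree-V m → CycTree-V m
CycTree-next m nothing              = nothing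
CycTree-next m (just ([] , _))      = nothing
CycTree-next m (just (b ∷ l , p))   = just (l , ≤-trans (n≤1+n _) p)

open import Data.Sum using (_⊎_; inj₁; inj₂)

module _ {q : ℕ} (K : FiniteField q) (L : FiniteField (q ℕ.* q))
         (E : FieldEmbedding K L) (a : FiniteField.Carrier K) where
  private
    module K = FiniteField K
    module L = FiniteField L
  open FieldEmbedding E

  f-map : L.Carrier → L.Carrier
  f-map X = (X L.^ (q ℕ.+ 1)) L.+ (ι a L.* (X L.^ 2))

  fq-map : K.Carrier → K.Carrier
  fq-map x = (a K.+ K.1#) K.* (x K.^ 2)

  Attached-V : Set
  Attached-V = K.Carrier ⊎ ((Σ K.Carrier λ α → K.χ₂ (α K.* (a K.- K.1#)) ≡ -[1+ 0 ]) × Fin 2)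

  Attached-next : Attached-V → Attached-V
  Attached-next (inj₁ x)            = inj₁ (fq-map x)
  Attached-next (inj₂ ((α , _) , _)) = inj₁ α

  InFqComponent : L.Carrier → Set
  InFqComponent x = ∃ λ y → SameComponent f-map x (ι y)

{-# OPTIONS --safe #-}
-- The Frobenius σ X = X ^ q is an involutive automorphism of F_{q²} with fixed field F_q, and
-- f X = σ X · X + a X², which is (a + 1) x² on F_q.  If f Z ∈ F_q but Z ∉ F_q, the norm σ Z · Z
-- lies in F_q, so Z² = c for a non-square c ∈ F_q, σ Z = -Z and f Z = (a - 1) c: the two square
-- roots of c are the vertices attached to α = (a - 1) c, and α (a - 1) is then a non-square.
-- Nothing maps to such a Z: σ (f Y) = -f Y gives a (σ Y)² + 2 σ Y · Y + a Y² = 0, and as 1 - a²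
-- is a square this forces σ Y = κ Y with κ ∈ F_q and κ² = 1, where κ = 1 puts f Y in F_q and
-- κ = -1 gives 2 (a - 1) Y² = 0.  For the fixed point b = 1/(a + 1), the preimages of b y are
-- b (± √y) when y is a square and the attached vertices otherwise; along y ^ (2 ^ j) = -1,
-- starting from y = -1, y is a square exactly while j < s - 1.  This gives Z*(4) for s = 1 and
-- a binary tree of height s + 1 hanging from the loop at b for s ≥ 2.
module Submission where

open import Defs
open import Level using (0ℓ)
open import Algebra.Bundles using (CommutativeRing; CommutativeMonoid; Semiring)
open import Algebra.Solver.Ring.AlmostCommutativeRing
  using (AlmostCommutativeRing; fromCommutativeRing; _-Raw-AlmostCommutative⟶_)
import Algebra.Properties.CommutativeMonoid.Sum as CommutativeMonoidSum
import Algebra.Properties.CommutativeSemiring.Binomial as Binomial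
import Algebra.Properties.Semiring.Exp as SemiringExp
import Algebra.Properties.Semiring.Mult as SemiringMult
import Algebra.Properties.Semiring.Sum as SemiringSum
open import Axiom.UniquenessOfIdentityProofs using (module Decidable⇒UIP)
open import Data.Bool using (Bool; true; false)
open import Data.Fin as Fin using (Fin; zero; suc; toℕ; inject₁; punchIn)
import Data.Fin.Properties as Fin
open import Data.Fin.Permutation using (Permutation; permutation)
open import Data.Integer as ℤ using (ℤ; -[1+_])
import Data.Integer.Properties as ℤ
open import Data.List using (List; []; _∷_; length; map; filter; allFin; replicate)
import Data.List.Properties as List
open import Data.List.Membership.Propositional using (_∈_)
import Data.List.Membership.Propositional.Properties as ∈
open import Data.List.Relation.Unary.All as All using (All; []; _∷_)
open import Data.List.Relation.Unary.All.Properties using (all-filter)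
open import Data.List.Relation.Unary.AllPairs using ([]; _∷_)
open import Data.List.Relation.Unary.Any using (here; there)
open import Data.List.Relation.Unary.Unique.Propositional using (Unique)
import Data.List.Relation.Unary.Unique.Propositional.Properties as Unique
open import Data.Maybe using (Maybe; just; nothing)
open import Data.Nat as ℕ using (ℕ; zero; suc; _≤_; _<_; z≤n; s≤s)
import Data.Nat.Properties as ℕ
open import Data.Nat.Combinatorics using (_C_; nCn≡1; nC1≡n; nCk+nC[k+1]≡[n+1]C[k+1])
open import Data.Nat.Divisibility using (_∣_; divides; ∣⇒≤)
open import Data.Nat.Primality using (Prime; euclidsLemma; prime⇒irreducible; prime?)
open import Data.Product using (Σ; ∃; _×_; _,_; proj₁; proj₂)
open import Data.Sign as Sign using (Sign)
open import Data.Sum using (_⊎_; inj₁; inj₂; [_,_]′; reduce)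
import Data.Sum.Properties as Sum
open import Data.Vec.Functional using (removeAt)
open import Function.Base using (_∘_)
open import Function.Bundles using (Inverse; mk⇔; Equivalence)
open import Function.Definitions using (Injective)
open import Relation.Binary.PropositionalEquality as ≡
  using (_≡_; _≢_; refl; sym; trans; cong; cong₂; subst; subst₂; module ≡-Reasoning)
open import Relation.Nullary using (¬_; Dec; yes; no; contradiction)
open import Relation.Nullary.Decidable using (_×-dec_; ¬?; from-yes)
open import Relation.Unary using (Pred; Decidable)

-- Arithmetic and counting

[1+k]*[1+n]C[1+k]≡[1+n]*nCk : ∀ n k → suc k ℕ.* (suc n C suc k) ≡ suc n ℕ.* (n C k)
[1+k]*[1+n]C[1+k]≡[1+n]*nCk zero    zero    = refl
[1+k]*[1+n]C[1+k]≡[1+n]*nCk zero    (suc k) = ℕ.*-zeroʳ (suc (suc k))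
[1+k]*[1+n]C[1+k]≡[1+n]*nCk (suc n) zero    = trans (ℕ.+-identityʳ _) (trans (nC1≡n (suc (suc n))) (sym (ℕ.*-identityʳ (suc (suc n)))))
[1+k]*[1+n]C[1+k]≡[1+n]*nCk (suc n) (suc k) = begin
  (2 + k) * (suc (suc n) C suc (suc k)) ≡⟨ cong ((2 + k) *_) (nCk+nC[k+1]≡[n+1]C[k+1] (suc n) (suc k)) ⟨
  (2 + k) * (a + b)
    ≡⟨ solve 3 (λ k a b → (con 2 :+ k) :* (a :+ b) := a :+ (con 1 :+ k) :* a :+ (con 2 :+ k) :* b) refl k a b ⟩
  a + (1 + k) * a + (2 + k) * b
    ≡⟨ cong₂ (λ u v → a + u + v) ([1+k]*[1+n]C[1+k]≡[1+n]*nCk n k) ([1+k]*[1+n]C[1+k]≡[1+n]*nCk n (suc k)) ⟩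
  a + (1 + n) * c + (1 + n) * d
    ≡⟨ solve 4 (λ n a c d → a :+ (con 1 :+ n) :* c :+ (con 1 :+ n) :* d := a :+ (con 1 :+ n) :* (c :+ d)) refl n a c d ⟩
  a + (1 + n) * (c + d)                ≡⟨ cong (λ u → a + (1 + n) * u) (nCk+nC[k+1]≡[n+1]C[k+1] n k) ⟩
  a + (1 + n) * a                      ≡⟨ solve 2 (λ n a → a :+ (con 1 :+ n) :* a := (con 2 :+ n) :* a) refl n a ⟩
  (2 + n) * a                          ∎
  where
  open ≡-Reasoning
  open import Data.Nat using (_+_; _*_)
  open import Data.Nat.Solver using (module +-*-Solver)
  open +-*-Solver
  a b c d : ℕ
  a = suc n C suc k
  b = suc n C suc (suc k)
  c = n C k
  d = n C suc k

p∣pCk : ∀ p k → Prime p → 0 < k → k < p → p ∣ (p C k)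
p∣pCk (suc p) (suc k) p-prime _ k<p
  with euclidsLemma (suc k) (suc p C suc k) p-prime
         (divides (p C k) (trans ([1+k]*[1+n]C[1+k]≡[1+n]*nCk p k) (ℕ.*-comm (suc p) _)))
... | inj₂ p∣pCk   = p∣pCk
... | inj₁ p∣1+k   = contradiction (ℕ.≤-trans k<p (∣⇒≤ p∣1+k)) (ℕ.<-irrefl refl)

¬2∣odd-prime : ∀ {p} → Prime p → ¬ p ≡ 2 → ¬ 2 ∣ p
¬2∣odd-prime p-prime p≢2 2∣p with prime⇒irreducible p-prime 2∣p
... | inj₁ ()
... | inj₂ 2≡p = p≢2 (sym 2≡p)

¬2∣^ : ∀ {p} k → ¬ 2 ∣ p → ¬ 2 ∣ p ℕ.^ k
¬2∣^ zero    _    (divides (suc c) ())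
¬2∣^ (suc k) ¬2∣p 2∣p^[1+k] with euclidsLemma _ _ (from-yes (prime? 2)) 2∣p^[1+k]
... | inj₁ 2∣p   = ¬2∣p 2∣p
... | inj₂ 2∣p^k = ¬2∣^ k ¬2∣p 2∣p^k

¬2∣⇒≡1+2* : ∀ q → ¬ 2 ∣ q → ∃ λ m → q ≡ suc (2 ℕ.* m)
¬2∣⇒≡1+2* zero          ¬2∣q = contradiction (divides 0 refl) ¬2∣q
¬2∣⇒≡1+2* (suc zero)    _    = 0 , refl
¬2∣⇒≡1+2* (suc (suc q)) ¬2∣q with ¬2∣⇒≡1+2* q (λ { (divides c q≡c*2) → ¬2∣q (divides (suc c) (cong (λ k → suc (suc k)) q≡c*2)) })
... | m , q≡1+2m = suc m , cong (λ k → suc (suc k)) (trans q≡1+2m (sym (ℕ.+-suc m (m ℕ.+ 0))))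

2*m≡2^s*r⇒s≡1+s′ : ∀ {m} s r → 2 ℕ.* m ≡ 2 ℕ.^ s ℕ.* r → ¬ 2 ∣ r → ∃ λ s′ → s ≡ suc s′ × m ≡ 2 ℕ.^ s′ ℕ.* r
2*m≡2^s*r⇒s≡1+s′ {m} zero    r 2m≡r ¬2∣r = contradiction (divides m (trans (sym (trans 2m≡r (ℕ.+-identityʳ r))) (ℕ.*-comm 2 m))) ¬2∣r
2*m≡2^s*r⇒s≡1+s′ {m} (suc s′) r 2m≡2^[1+s′]r _ = s′ , refl , ℕ.*-cancelˡ-≡ m _ 2 (trans 2m≡2^[1+s′]r (ℕ.*-assoc 2 (2 ℕ.^ s′) r))

2^s*r≡2^j*[2*w] : ∀ {j s} r → j < s → 2 ℕ.^ s ℕ.* r ≡ 2 ℕ.^ j ℕ.* (2 ℕ.* (2 ℕ.^ (s ℕ.∸ suc j) ℕ.* r))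
2^s*r≡2^j*[2*w] {j} {s} r j<s = begin
  2 ℕ.^ s ℕ.* r                              ≡⟨ cong (λ e → 2 ℕ.^ e ℕ.* r) (ℕ.m+[n∸m]≡n j<s) ⟨
  2 ℕ.^ (suc j ℕ.+ (s ℕ.∸ suc j)) ℕ.* r      ≡⟨ cong (ℕ._* r) (ℕ.^-distribˡ-+-* 2 (suc j) (s ℕ.∸ suc j)) ⟩
  2 ℕ.* 2 ℕ.^ j ℕ.* 2 ℕ.^ (s ℕ.∸ suc j) ℕ.* r
    ≡⟨ solve 3 (λ a b c → con 2 :* a :* b :* c := a :* (con 2 :* (b :* c))) refl (2 ℕ.^ j) (2 ℕ.^ (s ℕ.∸ suc j)) r ⟩
  2 ℕ.^ j ℕ.* (2 ℕ.* (2 ℕ.^ (s ℕ.∸ suc j) ℕ.* r)) ∎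
  where
  open ≡-Reasoning
  open import Data.Nat.Solver using (module +-*-Solver)
  open +-*-Solver

module _ {A : Set} where

  length-filter-split : ∀ {P : Pred A 0ℓ} (P? : Decidable P) xs →
    length xs ≡ length (filter P? xs) ℕ.+ length (filter (¬? ∘ P?) xs)
  length-filter-split P? [] = refl
  length-filter-split P? (x ∷ xs) with P? x
  ... | yes _ = cong suc (length-filter-split P? xs)
  ... | no _  = trans (cong suc (length-filter-split P? xs)) (sym (ℕ.+-suc _ _))

  length≤k*length-image : ∀ {B : Set} (f : A → B) (k : ℕ) → (∀ (u v : B) → Dec (u ≡ v)) →
    (∀ y (zs : List A) → Unique zs → All (λ z → f z ≡ y) zs → length zs ≤ k) →
    ∀ (ys : List B) (xs : List A) → Unique xs → (∀ x → x ∈ xs → f x ∈ ys) →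
    length xs ≤ k ℕ.* length ys
  length≤k*length-image f k _≟_ fibre≤k [] [] _ _ = z≤n
  length≤k*length-image f k _≟_ fibre≤k [] (x ∷ xs) _ f∈ with f∈ x (here refl)
  ... | ()
  length≤k*length-image f k _≟_ fibre≤k (y ∷ ys) xs xs-unique f∈ = begin
    length xs                                                        ≡⟨ length-filter-split P? xs ⟩
    length (filter P? xs) ℕ.+ length (filter (¬? ∘ P?) xs)           ≤⟨ ℕ.+-mono-≤ fibre rest ⟩
    k ℕ.+ k ℕ.* length ys                                            ≡⟨ ℕ.*-suc k (length ys) ⟨
    k ℕ.* suc (length ys)                                            ∎
    where
    open ℕ.≤-Reasoning
    P? : Decidable (λ x → f x ≡ y)
    P? x = f x ≟ y
    fibre : length (filter P? xs) ≤ k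
    fibre = fibre≤k y _ (Unique.filter⁺ P? xs-unique) (all-filter P? xs)
    f∈ys : ∀ x → x ∈ filter (¬? ∘ P?) xs → f x ∈ ys
    f∈ys x x∈ with ∈.∈-filter⁻ (¬? ∘ P?) x∈
    ... | x∈xs , fx≢y with f∈ x x∈xs
    ...   | here fx≡y = contradiction fx≡y fx≢y
    ...   | there fx∈ys = fx∈ys
    rest : length (filter (¬? ∘ P?) xs) ≤ k ℕ.* length ys
    rest = length≤k*length-image f k _≟_ fibre≤k ys _ (Unique.filter⁺ (¬? ∘ P?) xs-unique) f∈ys

-- Finite fields

-- Algebra.Solver.Ring needs coefficients with decidable equality, which an abstract field
-- lacks, so integer coefficients are interpreted through ℤ → R.  The optimised ×′ makes
-- ⟦ + 1 ⟧ reduce to 1#, so constants :1 below need no transport.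
module IntegerCoefficients (R : CommutativeRing 0ℓ 0ℓ) where
  open import Data.Integer using (+_; _⊖_; _◃_; sign; ∣_∣)
  open CommutativeRing R renaming (refl to ≈-refl; sym to ≈-sym; trans to ≈-trans)
  open import Algebra.Properties.Ring ring using (-0#≈0#; -‿distribˡ-*; -‿distribʳ-*; -‿involutive; -‿+-comm)
  open import Algebra.Properties.Semiring.Mult.TCOptimised semiring using (×-homo-+; ×1-homo-*) renaming (_×_ to _×′_)
  open import Relation.Binary.Reasoning.Setoid setoid

  ⟦_⟧ : ℤ → Carrier
  ⟦ + n ⟧      = n ×′ 1#
  ⟦ -[1+ n ] ⟧ = - (suc n ×′ 1#)

  signed : Sign → Carrier → Carrier
  signed Sign.+ x = x
  signed Sign.- x = - x

  ⟦⊖⟧ : ∀ m n → ⟦ m ⊖ n ⟧ ≈ m ×′ 1# - n ×′ 1#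
  ⟦⊖⟧ zero    zero    = ≈-sym (≈-trans (+-identityˡ _) -0#≈0#)
  ⟦⊖⟧ zero    (suc n) = ≈-sym (+-identityˡ _)
  ⟦⊖⟧ (suc m) zero    = ≈-sym (≈-trans (+-congˡ -0#≈0#) (+-identityʳ _))
  ⟦⊖⟧ (suc m) (suc n) = begin
    ⟦ suc m ⊖ suc n ⟧                  ≡⟨ ≡.cong ⟦_⟧ (ℤ.[1+m]⊖[1+n]≡m⊖n m n) ⟩
    ⟦ m ⊖ n ⟧                          ≈⟨ ⟦⊖⟧ m n ⟩
    m ×′ 1# - n ×′ 1#                  ≈⟨ ≈-sym (+-sub-+ 1# _ _) ⟩
    (1# + m ×′ 1#) - (1# + n ×′ 1#)    ≈⟨ ≈-sym (+-cong (×-homo-+ 1# 1 m) (-‿cong (×-homo-+ 1# 1 n))) ⟩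
    suc m ×′ 1# - suc n ×′ 1#          ∎
    where
    +-sub-+ : ∀ x y z → (x + y) - (x + z) ≈ y - z
    +-sub-+ x y z = begin
      (x + y) - (x + z)               ≈⟨ +-cong (+-comm x y) (≈-sym (-‿+-comm x z)) ⟩
      (y + x) + (- x - z)             ≈⟨ +-assoc y x _ ⟩
      y + (x + (- x - z))             ≈⟨ +-congˡ (≈-sym (+-assoc x (- x) _)) ⟩
      y + ((x - x) - z)               ≈⟨ +-congˡ (+-congʳ (-‿inverseʳ x)) ⟩
      y + (0# - z)                    ≈⟨ +-congˡ (+-identityˡ _) ⟩
      y - z                           ∎

  ⟦◃⟧ : ∀ s n → ⟦ s ◃ n ⟧ ≈ signed s (n ×′ 1#)
  ⟦◃⟧ Sign.+ zero    = ≈-refl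
  ⟦◃⟧ Sign.- zero    = ≈-sym -0#≈0#
  ⟦◃⟧ Sign.+ (suc n) = ≈-refl
  ⟦◃⟧ Sign.- (suc n) = ≈-refl

  ⟦⟧-signed-abs : ∀ i → ⟦ i ⟧ ≈ signed (sign i) (∣ i ∣ ×′ 1#)
  ⟦⟧-signed-abs (+ n)    = ≈-refl
  ⟦⟧-signed-abs -[1+ n ] = ≈-refl

  signed-* : ∀ s t x y → signed (s Sign.* t) (x * y) ≈ signed s x * signed t y
  signed-* Sign.+ Sign.+ x y = ≈-refl
  signed-* Sign.+ Sign.- x y = -‿distribʳ-* x y
  signed-* Sign.- Sign.+ x y = -‿distribˡ-* x y
  signed-* Sign.- Sign.- x y = begin
    x * y             ≈⟨ ≈-sym (-‿involutive _) ⟩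
    - - (x * y)       ≈⟨ -‿cong (-‿distribʳ-* x y) ⟩
    - (x * - y)       ≈⟨ -‿distribˡ-* x (- y) ⟩
    - x * - y         ∎

  signed-cong : ∀ s {x y} → x ≈ y → signed s x ≈ signed s y
  signed-cong Sign.+ e = e
  signed-cong Sign.- e = -‿cong e

  ⟦⟧-+ : ∀ i j → ⟦ i ℤ.+ j ⟧ ≈ ⟦ i ⟧ + ⟦ j ⟧
  ⟦⟧-+ (+ m)    (+ n)    = ×-homo-+ 1# m n
  ⟦⟧-+ (+ m)    -[1+ n ] = ⟦⊖⟧ m (suc n)
  ⟦⟧-+ -[1+ m ] (+ n)    = ≈-trans (⟦⊖⟧ n (suc m)) (+-comm _ _)
  ⟦⟧-+ -[1+ m ] -[1+ n ] = begin
    - (suc (suc (m ℕ.+ n)) ×′ 1#)        ≡⟨ ≡.cong (λ k → - (suc k ×′ 1#)) (≡.sym (ℕ.+-suc m n)) ⟩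
    - ((suc m ℕ.+ suc n) ×′ 1#)          ≈⟨ -‿cong (×-homo-+ 1# (suc m) (suc n)) ⟩
    - (suc m ×′ 1# + suc n ×′ 1#)        ≈⟨ ≈-sym (-‿+-comm _ _) ⟩
    - (suc m ×′ 1#) + - (suc n ×′ 1#)    ∎

  ⟦⟧-* : ∀ i j → ⟦ i ℤ.* j ⟧ ≈ ⟦ i ⟧ * ⟦ j ⟧
  ⟦⟧-* i j = begin
    ⟦ (sign i Sign.* sign j) ◃ (∣ i ∣ ℕ.* ∣ j ∣) ⟧
      ≈⟨ ⟦◃⟧ (sign i Sign.* sign j) (∣ i ∣ ℕ.* ∣ j ∣) ⟩
    signed (sign i Sign.* sign j) ((∣ i ∣ ℕ.* ∣ j ∣) ×′ 1#)
      ≈⟨ signed-cong (sign i Sign.* sign j) (×1-homo-* ∣ i ∣ ∣ j ∣) ⟩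
    signed (sign i Sign.* sign j) (∣ i ∣ ×′ 1# * ∣ j ∣ ×′ 1#)
      ≈⟨ signed-* (sign i) (sign j) _ _ ⟩
    signed (sign i) (∣ i ∣ ×′ 1#) * signed (sign j) (∣ j ∣ ×′ 1#)
      ≈⟨ ≈-sym (*-cong (⟦⟧-signed-abs i) (⟦⟧-signed-abs j)) ⟩
    ⟦ i ⟧ * ⟦ j ⟧
      ∎

  ⟦⟧-neg : ∀ i → ⟦ ℤ.- i ⟧ ≈ - ⟦ i ⟧
  ⟦⟧-neg -[1+ n ]    = ≈-sym (-‿involutive _)
  ⟦⟧-neg (+ zero)    = ≈-sym -0#≈0#
  ⟦⟧-neg (+ suc n)   = ≈-refl

  almostCommutativeRing : AlmostCommutativeRing 0ℓ 0ℓ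
  almostCommutativeRing = fromCommutativeRing R

  homomorphism : ℤ.+-*-rawRing -Raw-AlmostCommutative⟶ almostCommutativeRing
  homomorphism = record
    { ⟦_⟧ = ⟦_⟧ ; +-homo = ⟦⟧-+ ; *-homo = ⟦⟧-* ; -‿homo = ⟦⟧-neg
    ; 0-homo = ≈-refl ; 1-homo = ≈-refl }

module FieldProperties {n : ℕ} (F : FiniteField n) where
  open FiniteField F public
  open ≡-Reasoning

  commutativeRing : CommutativeRing 0ℓ 0ℓ
  commutativeRing = record { isCommutativeRing = isCommutativeRing }

  open CommutativeRing commutativeRing public
    using ( +-assoc; +-comm; +-identityˡ; +-identityʳ; -‿inverseʳ; -‿inverseˡ
          ; *-assoc; *-comm; *-identityˡ; *-identityʳ; zeroˡ; zeroʳ)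
  open import Algebra.Properties.Group (CommutativeRing.+-group commutativeRing) public
    using () renaming (x∙y⁻¹≈ε⇒x≈y to x-y≡0⇒x≡y; x≈y⇒x∙y⁻¹≈ε to x≡y⇒x-y≡0; inverseʳ-unique to x+y≡0⇒y≡-x)
  open import Algebra.Properties.Ring (CommutativeRing.ring commutativeRing) public
    using () renaming (x+x≈x⇒x≈0 to x+x≡x⇒x≡0)

  private module ℤR = IntegerCoefficients commutativeRing

  coefficient≟ : ∀ i j → Maybe (ℤR.⟦ i ⟧ ≡ ℤR.⟦ j ⟧)
  coefficient≟ i j with i ℤ.≟ j
  ... | yes i≡j = just (cong ℤR.⟦_⟧ i≡j)
  ... | no _    = nothing

  open import Algebra.Solver.Ring ℤ.+-*-rawRing ℤR.almostCommutativeRing ℤR.homomorphism coefficient≟ public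

  open SemiringMult (CommutativeRing.semiring commutativeRing) public using () renaming (_×_ to _·_)

  fromℕ : ℕ → Carrier
  fromℕ k = k · 1#

  fromℕ-* : ∀ a b → fromℕ (a ℕ.* b) ≡ fromℕ a * fromℕ b
  fromℕ-* = SemiringMult.×1-homo-* (CommutativeRing.semiring commutativeRing)

  :0 :1 : ∀ {k} → Polynomial k
  :0 = con (ℤ.+ 0)
  :1 = con (ℤ.+ 1)

  1≢0 : ¬ 1# ≡ 0#
  1≢0 1≡0 = 0≢1 (sym 1≡0)

  inv : ∀ x → ¬ x ≡ 0# → Carrier
  inv x x≢0 = proj₁ (inverse x x≢0)

  *-inverseʳ : ∀ x (x≢0 : ¬ x ≡ 0#) → x * inv x x≢0 ≡ 1#
  *-inverseʳ x x≢0 = proj₂ (inverse x x≢0)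

  *-inverseˡ : ∀ x (x≢0 : ¬ x ≡ 0#) → inv x x≢0 * x ≡ 1#
  *-inverseˡ x x≢0 = trans (*-comm _ _) (*-inverseʳ x x≢0)

  inv-*-cancelˡ : ∀ x (x≢0 : ¬ x ≡ 0#) y → inv x x≢0 * (x * y) ≡ y
  inv-*-cancelˡ x x≢0 y = begin
    inv x x≢0 * (x * y)  ≡⟨ *-assoc _ _ _ ⟨
    (inv x x≢0 * x) * y  ≡⟨ cong (_* y) (*-inverseˡ x x≢0) ⟩
    1# * y               ≡⟨ *-identityˡ y ⟩
    y                    ∎

  *-cancelˡ : ∀ {x y z} → ¬ x ≡ 0# → x * y ≡ x * z → y ≡ z
  *-cancelˡ {x} {y} {z} x≢0 e = begin
    y                    ≡⟨ inv-*-cancelˡ x x≢0 y ⟨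
    inv x x≢0 * (x * y)  ≡⟨ cong (inv x x≢0 *_) e ⟩
    inv x x≢0 * (x * z)  ≡⟨ inv-*-cancelˡ x x≢0 z ⟩
    z                    ∎

  *-cancelʳ : ∀ {x y z} → ¬ x ≡ 0# → y * x ≡ z * x → y ≡ z
  *-cancelʳ {x} {y} {z} x≢0 e = *-cancelˡ x≢0 (trans (*-comm x y) (trans e (*-comm z x)))

  x*y≡0⇒x≡0⊎y≡0 : ∀ {x y} → x * y ≡ 0# → x ≡ 0# ⊎ y ≡ 0#
  x*y≡0⇒x≡0⊎y≡0 {x} {y} e with x ≟ 0#
  ... | yes x≡0 = inj₁ x≡0
  ... | no x≢0  = inj₂ (*-cancelˡ x≢0 (trans e (sym (zeroʳ x))))

  *-≢0 : ∀ {x y} → ¬ x ≡ 0# → ¬ y ≡ 0# → ¬ x * y ≡ 0#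
  *-≢0 x≢0 y≢0 e = [ x≢0 , y≢0 ]′ (x*y≡0⇒x≡0⊎y≡0 e)

  x*x≡0⇒x≡0 : ∀ {x} → x * x ≡ 0# → x ≡ 0#
  x*x≡0⇒x≡0 e = reduce (x*y≡0⇒x≡0⊎y≡0 e)

  x*x≡y*y⇒x≡y⊎x≡-y : ∀ {x y} → x * x ≡ y * y → x ≡ y ⊎ x ≡ - y
  x*x≡y*y⇒x≡y⊎x≡-y {x} {y} e with x*y≡0⇒x≡0⊎y≡0 difference-of-squares
    where
    difference-of-squares : (x - y) * (x + y) ≡ 0#
    difference-of-squares = begin
      (x - y) * (x + y) ≡⟨ solve 2 (λ x y → (x :- y) :* (x :+ y) := x :* x :- y :* y) refl x y ⟩
      x * x - y * y     ≡⟨ x≡y⇒x-y≡0 e ⟩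
      0#                ∎
  ... | inj₁ x-y≡0 = inj₁ (x-y≡0⇒x≡y _ _ x-y≡0)
  ... | inj₂ x+y≡0 = inj₂ (x-y≡0⇒x≡y _ _ (trans (solve 2 (λ x y → x :- (:- y) := x :+ y) refl x y) x+y≡0))

  x*x≡1⇒x≡1⊎x≡-1 : ∀ {x} → x * x ≡ 1# → x ≡ 1# ⊎ x ≡ - 1#
  x*x≡1⇒x≡1⊎x≡-1 e = x*x≡y*y⇒x≡y⊎x≡-y (trans e (sym (*-identityˡ 1#)))

  -x*-x≡x*x : ∀ x → (- x) * (- x) ≡ x * x
  -x*-x≡x*x = solve 1 (λ x → (:- x) :* (:- x) := x :* x) refl

  -‿≢0 : ∀ {x} → ¬ x ≡ 0# → ¬ - x ≡ 0#
  -‿≢0 {x} x≢0 -x≡0 = x≢0 (begin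
    x        ≡⟨ solve 1 (λ x → x := :- (:- x)) refl x ⟩
    - (- x)  ≡⟨ cong -_ -x≡0 ⟩
    - 0#     ≡⟨ solve 0 (:- :0 := :0) refl ⟩
    0#       ∎)

  module _ (2≢0 : ¬ 1# + 1# ≡ 0#) where

    x≢-x : ∀ {x} → ¬ x ≡ 0# → ¬ x ≡ - x
    x≢-x {x} x≢0 x≡-x = [ 2≢0 , x≢0 ]′ (x*y≡0⇒x≡0⊎y≡0 (begin
      (1# + 1#) * x  ≡⟨ solve 1 (λ x → (:1 :+ :1) :* x := x :- (:- x)) refl x ⟩
      x - (- x)      ≡⟨ x≡y⇒x-y≡0 x≡-x ⟩
      0#             ∎))

    -1≢1 : ¬ - 1# ≡ 1#
    -1≢1 -1≡1 = x≢-x 1≢0 (sym -1≡1)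

  ^-distribˡ-+-* : ∀ x m k → x ^ (m ℕ.+ k) ≡ x ^ m * x ^ k
  ^-distribˡ-+-* x zero    k = sym (*-identityˡ _)
  ^-distribˡ-+-* x (suc m) k = trans (cong (x *_) (^-distribˡ-+-* x m k)) (sym (*-assoc _ _ _))

  ^-distribʳ-* : ∀ x y m → (x * y) ^ m ≡ x ^ m * y ^ m
  ^-distribʳ-* x y zero    = sym (*-identityˡ 1#)
  ^-distribʳ-* x y (suc m) = begin
    (x * y) * (x * y) ^ m        ≡⟨ cong ((x * y) *_) (^-distribʳ-* x y m) ⟩
    (x * y) * (x ^ m * y ^ m)    ≡⟨ solve 4 (λ x y a b → (x :* y) :* (a :* b) := (x :* a) :* (y :* b)) refl x y (x ^ m) (y ^ m) ⟩
    (x * x ^ m) * (y * y ^ m)    ∎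

  1^n≡1 : ∀ k → 1# ^ k ≡ 1#
  1^n≡1 zero    = refl
  1^n≡1 (suc k) = trans (*-identityˡ _) (1^n≡1 k)

  ^-*-assoc : ∀ x m k → (x ^ m) ^ k ≡ x ^ (m ℕ.* k)
  ^-*-assoc x zero    k = 1^n≡1 k
  ^-*-assoc x (suc m) k = begin
    (x * x ^ m) ^ k           ≡⟨ ^-distribʳ-* x (x ^ m) k ⟩
    x ^ k * (x ^ m) ^ k       ≡⟨ cong (x ^ k *_) (^-*-assoc x m k) ⟩
    x ^ k * x ^ (m ℕ.* k)     ≡⟨ ^-distribˡ-+-* x k (m ℕ.* k) ⟨
    x ^ (k ℕ.+ m ℕ.* k)       ∎

  x^2≡x*x : ∀ x → x ^ 2 ≡ x * x
  x^2≡x*x x = cong (x *_) (*-identityʳ x)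

  x^n≢0 : ∀ {x} k → ¬ x ≡ 0# → ¬ x ^ k ≡ 0#
  x^n≢0 zero    x≢0 = 1≢0
  x^n≢0 (suc k) x≢0 = *-≢0 x≢0 (x^n≢0 k x≢0)

  x^n≡0⇒x≡0 : ∀ {x} k → x ^ k ≡ 0# → x ≡ 0#
  x^n≡0⇒x≡0 {x} k e with x ≟ 0#
  ... | yes x≡0 = x≡0
  ... | no x≢0  = contradiction e (x^n≢0 k x≢0)

  -1^[2k]≡1 : ∀ k → (- 1#) ^ (2 ℕ.* k) ≡ 1#
  -1^[2k]≡1 k = begin
    (- 1#) ^ (2 ℕ.* k)   ≡⟨ ^-*-assoc (- 1#) 2 k ⟨
    ((- 1#) ^ 2) ^ k     ≡⟨ cong (_^ k) (trans (x^2≡x*x (- 1#)) (trans (-x*-x≡x*x 1#) (*-identityˡ 1#))) ⟩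
    1# ^ k               ≡⟨ 1^n≡1 k ⟩
    1#                   ∎

  -1^[1+2k]≡-1 : ∀ k → (- 1#) ^ suc (2 ℕ.* k) ≡ - 1#
  -1^[1+2k]≡-1 k = trans (cong ((- 1#) *_) (-1^[2k]≡1 k)) (*-identityʳ _)

  square-* : ∀ {x y} → IsSquare x → IsSquare y → IsSquare (x * y)
  square-* {x} {y} (u , u²≡x) (v , v²≡y) = u * v , (begin
    (u * v) * (u * v)  ≡⟨ solve 2 (λ u v → (u :* v) :* (u :* v) := (u :* u) :* (v :* v)) refl u v ⟩
    (u * u) * (v * v)  ≡⟨ cong₂ _*_ u²≡x v²≡y ⟩
    x * y              ∎)

  nonSquare-*-square : ∀ {u d} → ¬ u ≡ 0# → ¬ IsSquare d → ¬ IsSquare ((u * u) * d)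
  nonSquare-*-square {u} {d} u≢0 d-nonSquare (v , v²≡u²d) = d-nonSquare (u⁻¹ * v , (begin
    (u⁻¹ * v) * (u⁻¹ * v)      ≡⟨ solve 2 (λ i v → (i :* v) :* (i :* v) := (i :* i) :* (v :* v)) refl u⁻¹ v ⟩
    (u⁻¹ * u⁻¹) * (v * v)      ≡⟨ cong ((u⁻¹ * u⁻¹) *_) v²≡u²d ⟩
    (u⁻¹ * u⁻¹) * ((u * u) * d) ≡⟨ solve 3 (λ i u d → (i :* i) :* ((u :* u) :* d) := ((i :* u) :* (i :* u)) :* d) refl u⁻¹ u d ⟩
    ((u⁻¹ * u) * (u⁻¹ * u)) * d ≡⟨ cong (λ w → (w * w) * d) (*-inverseˡ u u≢0) ⟩
    (1# * 1#) * d              ≡⟨ solve 1 (λ d → (:1 :* :1) :* d := d) refl d ⟩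
    d                          ∎))
    where
    u⁻¹ : Carrier
    u⁻¹ = inv u u≢0

  χ₂≡-1⇒nonSquare : ∀ x → χ₂ x ≡ -[1+ 0 ] → ¬ x ≡ 0# × ¬ IsSquare x
  χ₂≡-1⇒nonSquare x e with x ≟ 0#
  ... | yes _ = contradiction e λ ()
  ... | no x≢0 with isSquare? x
  ...   | yes _          = contradiction e λ ()
  ...   | no x-nonSquare = x≢0 , x-nonSquare

  nonSquare⇒χ₂≡-1 : ∀ x → ¬ x ≡ 0# → ¬ IsSquare x → χ₂ x ≡ -[1+ 0 ]
  nonSquare⇒χ₂≡-1 x x≢0 x-nonSquare with x ≟ 0#
  ... | yes x≡0 = contradiction x≡0 x≢0
  ... | no _ with isSquare? x
  ...   | yes x-square = contradiction x-square x-nonSquare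
  ...   | no _         = refl

  χ₂≡1⇒square : ∀ x → χ₂ x ≡ ℤ.+ 1 → ¬ x ≡ 0# × IsSquare x
  χ₂≡1⇒square x e with x ≟ 0#
  ... | yes _ = contradiction e λ ()
  ... | no x≢0 with isSquare? x
  ...   | yes x-square = x≢0 , x-square
  ...   | no _         = contradiction e λ ()

module FiniteFieldProperties {n : ℕ} (F : FiniteField n) where
  open FieldProperties F
  open ≡-Reasoning

  element : Fin n → Carrier
  element = Inverse.from enumeration

  index : Carrier → Fin n
  index = Inverse.to enumeration

  element-index : ∀ x → element (index x) ≡ x
  element-index = Inverse.strictlyInverseʳ enumeration

  index-element : ∀ i → index (element i) ≡ i
  index-element = Inverse.strictlyInverseˡ enumeration

  elements : List Carrier
  elements = map element (allFin n)

  length-elements : length elements ≡ n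
  length-elements = trans (List.length-map element (allFin n)) (List.length-tabulate (λ i → i))

  elements-unique : Unique elements
  elements-unique = Unique.map⁺ (λ {i} {j} eᵢ≡eⱼ → trans (sym (index-element i)) (trans (cong index eᵢ≡eⱼ) (index-element j)))
                                (Unique.allFin⁺ n)

  ∈-elements : ∀ x → x ∈ elements
  ∈-elements x = subst (_∈ elements) (element-index x) (∈.∈-map⁺ element (∈.∈-allFin (index x)))

  module _ (M : CommutativeMonoid 0ℓ 0ℓ) where
    open CommutativeMonoid M using () renaming (Carrier to Mᶜ; _≈_ to _≈ᴹ_)
    open CommutativeMonoidSum M using (sum; sum-cong-≗; sum-permute)

    sum-bijection : (g : Carrier → Mᶜ) (h h⁻¹ : Carrier → Carrier) →
                    (∀ x → h (h⁻¹ x) ≡ x) → (∀ x → h⁻¹ (h x) ≡ x) →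
                    sum (g ∘ element) ≈ᴹ sum (g ∘ h ∘ element)
    sum-bijection g h h⁻¹ inverseˡ inverseʳ = subst (sum (g ∘ element) ≈ᴹ_)
      (sum-cong-≗ (cong g ∘ element-index ∘ h ∘ element))
      (sum-permute (g ∘ element) π)
      where
      π : Permutation n n
      π = permutation (index ∘ h ∘ element) (index ∘ h⁻¹ ∘ element)
            (λ i → trans (cong (index ∘ h) (element-index _)) (trans (cong index (inverseˡ _)) (index-element i)))
            (λ i → trans (cong (index ∘ h⁻¹) (element-index _)) (trans (cong index (inverseʳ _)) (index-element i)))

  private
    module Σ+ = CommutativeMonoidSum (CommutativeRing.+-commutativeMonoid commutativeRing)
    module Π* = CommutativeMonoidSum (CommutativeRing.*-commutativeMonoid commutativeRing)

  -- Adding 1 permutes the elements, so n · 1 = ∑ (x + 1) - ∑ x = 0.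
  characteristic : fromℕ n ≡ 0#
  characteristic = begin
    fromℕ n                            ≡⟨ solve 2 (λ s c → c := (s :+ c) :- s) refl S (fromℕ n) ⟩
    (S + fromℕ n) - S                  ≡⟨ cong (λ w → (S + w) - S) (Σ+.sum-replicate n) ⟨
    (S + Σ+.sum {n} (λ _ → 1#)) - S    ≡⟨ cong (_- S) (Σ+.∑-distrib-+ element (λ _ → 1#)) ⟨
    Σ+.sum (λ i → element i + 1#) - S  ≡⟨ cong (_- S) (sum-bijection (CommutativeRing.+-commutativeMonoid commutativeRing)
                                                       (λ x → x) (_+ 1#) (_- 1#) +1-1 -1+1) ⟨
    S - S                              ≡⟨ -‿inverseʳ S ⟩
    0#                                 ∎
    where
    S : Carrier
    S = Σ+.sum element
    +1-1 : ∀ x → (x - 1#) + 1# ≡ x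
    +1-1 = solve 1 (λ x → (x :- :1) :+ :1 := x) refl
    -1+1 : ∀ x → (x + 1#) - 1# ≡ x
    -1+1 = solve 1 (λ x → (x :+ :1) :- :1 := x) refl

  n≡2+[n∸2] : n ≡ suc (suc (n ℕ.∸ 2))
  n≡2+[n∸2] = twoElements (index 0#) (index 1#) (λ i₀≡i₁ → 0≢1 (trans (sym (element-index 0#)) (trans (cong element i₀≡i₁) (element-index 1#))))
    where
    twoElements : ∀ {k} (i j : Fin k) → i ≢ j → k ≡ suc (suc (k ℕ.∸ 2))
    twoElements {suc zero}    zero zero i≢j = contradiction refl i≢j
    twoElements {suc (suc k)} _    _    _   = refl

  n≡1+[n∸1] : n ≡ suc (n ℕ.∸ 1)
  n≡1+[n∸1] = nonEmpty (index 0#)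
    where
    nonEmpty : ∀ {k} → Fin k → k ≡ suc (k ℕ.∸ 1)
    nonEmpty {suc k} _ = refl

  ∏-const : ∀ m x → Π*.sum {m} (λ _ → x) ≡ x ^ m
  ∏-const zero    x = refl
  ∏-const (suc m) x = cong (x *_) (∏-const m x)

  ∏-≢0 : ∀ {m} (f : Fin m → Carrier) → (∀ i → ¬ f i ≡ 0#) → ¬ Π*.sum f ≡ 0#
  ∏-≢0 {zero}  f f≢0 = 1≢0
  ∏-≢0 {suc m} f f≢0 = *-≢0 (f≢0 zero) (∏-≢0 (f ∘ suc) (f≢0 ∘ suc))

  ∏-scale-except : ∀ {m} (j : Fin m) x (f g : Fin m → Carrier) → f j ≡ g j →
                   (∀ i → i ≢ j → f i ≡ x * g i) → Π*.sum f ≡ x ^ (m ℕ.∸ 1) * Π*.sum g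
  ∏-scale-except {suc m} j x f g fj≡gj f≡xg = begin
    Π*.sum f                                       ≡⟨ Π*.sum-remove f ⟩
    f j * Π*.sum (removeAt f j)                    ≡⟨ cong₂ _*_ fj≡gj (Π*.sum-cong-≗ (λ k → f≡xg _ (Fin.punchInᵢ≢i j k))) ⟩
    g j * Π*.sum (λ k → x * g (punchIn j k))       ≡⟨ cong (g j *_) (Π*.∑-distrib-+ (λ _ → x) (removeAt g j)) ⟩
    g j * (Π*.sum {m} (λ _ → x) * Π*.sum (removeAt g j))
                                                   ≡⟨ cong (λ w → g j * (w * Π*.sum (removeAt g j))) (∏-const m x) ⟩
    g j * (x ^ m * Π*.sum (removeAt g j))          ≡⟨ solve 3 (λ a b c → a :* (b :* c) := b :* (a :* c)) refl (g j) (x ^ m) _ ⟩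
    x ^ m * (g j * Π*.sum (removeAt g j))          ≡⟨ cong (x ^ m *_) (Π*.sum-remove g) ⟨
    x ^ m * Π*.sum g                               ∎

  -- 0 is replaced by 1, so that multiplication by x ≢ 0 permutes the factors of ∏ unit.
  unit : Carrier → Carrier
  unit y with y ≟ 0#
  ... | yes _ = 1#
  ... | no _  = y

  unit≢0 : ∀ y → ¬ unit y ≡ 0#
  unit≢0 y with y ≟ 0#
  ... | yes _   = 1≢0
  ... | no y≢0  = y≢0

  unit-≡0 : ∀ {y} → y ≡ 0# → unit y ≡ 1#
  unit-≡0 {y} y≡0 with y ≟ 0#
  ... | yes _   = refl
  ... | no y≢0  = contradiction y≡0 y≢0

  unit-≢0 : ∀ {y} → ¬ y ≡ 0# → unit y ≡ y
  unit-≢0 {y} y≢0 with y ≟ 0#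
  ... | yes y≡0 = contradiction y≡0 y≢0
  ... | no _    = refl

  fermat : ∀ x → ¬ x ≡ 0# → x ^ (n ℕ.∸ 1) ≡ 1#
  fermat x x≢0 = *-cancelʳ (∏-≢0 (unit ∘ element) (unit≢0 ∘ element)) (begin
    x ^ (n ℕ.∸ 1) * P                   ≡⟨ ∏-scale-except (index 0#) x _ _ at-zero elsewhere ⟨
    Π*.sum (unit ∘ (x *_) ∘ element)    ≡⟨ sum-bijection (CommutativeRing.*-commutativeMonoid commutativeRing)
                                              unit (x *_) (inv x x≢0 *_) *-inv (inv-*-cancelˡ x x≢0) ⟨
    P                                   ≡⟨ *-identityˡ P ⟨
    1# * P                              ∎)
    where
    P : Carrier
    P = Π*.sum (unit ∘ element)
    *-inv : ∀ y → x * (inv x x≢0 * y) ≡ y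
    *-inv y = trans (sym (*-assoc _ _ _)) (trans (cong (_* y) (*-inverseʳ x x≢0)) (*-identityˡ y))
    at-zero : unit (x * element (index 0#)) ≡ unit (element (index 0#))
    at-zero = trans (unit-≡0 (trans (cong (x *_) (element-index 0#)) (zeroʳ x)))
                    (sym (unit-≡0 (element-index 0#)))
    elsewhere : ∀ i → i ≢ index 0# → unit (x * element i) ≡ x * unit (element i)
    elsewhere i i≢0 = trans (unit-≢0 (*-≢0 x≢0 eᵢ≢0)) (cong (x *_) (sym (unit-≢0 eᵢ≢0)))
      where
      eᵢ≢0 : ¬ element i ≡ 0#
      eᵢ≢0 eᵢ≡0 = i≢0 (trans (sym (index-element i)) (cong index eᵢ≡0))

  x^n≡x : ∀ x → x ^ n ≡ x
  x^n≡x x = trans (cong (x ^_) n≡1+[n∸1]) (power (x ≟ 0#))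
    where
    power : Dec (x ≡ 0#) → x * x ^ (n ℕ.∸ 1) ≡ x
    power (yes x≡0) = trans (cong (_* x ^ (n ℕ.∸ 1)) x≡0) (trans (zeroˡ _) (sym x≡0))
    power (no x≢0)  = trans (cong (x *_) (fermat x x≢0)) (*-identityʳ x)

  1+1≢0 : ∀ m → n ≡ suc (2 ℕ.* m) → ¬ 1# + 1# ≡ 0#
  1+1≢0 m n≡1+2m 1+1≡0 = 1≢0 (begin
    1#                            ≡⟨ +-identityʳ 1# ⟨
    1# + 0#                       ≡⟨ cong (1# +_) (zeroˡ (fromℕ m)) ⟨
    1# + 0# * fromℕ m             ≡⟨ cong (λ w → 1# + w * fromℕ m) (trans (cong (1# +_) (+-identityʳ 1#)) 1+1≡0) ⟨
    1# + fromℕ 2 * fromℕ m        ≡⟨ cong (1# +_) (fromℕ-* 2 m) ⟨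
    fromℕ (suc (2 ℕ.* m))         ≡⟨ cong fromℕ n≡1+2m ⟨
    fromℕ n                       ≡⟨ characteristic ⟩
    0#                            ∎)

module MonicPolynomials {n : ℕ} (F : FiniteField n) where
  open FieldProperties F
  open ≡-Reasoning

  -- c₀ ∷ c₁ ∷ ⋯ ∷ c_{d-1} ∷ [] stands for c₀ + c₁ X + ⋯ + c_{d-1} X^(d-1) + X^d
  evalMonic : List Carrier → Carrier → Carrier
  evalMonic []       x = 1#
  evalMonic (c ∷ cs) x = c + x * evalMonic cs x

  divideByLinear : Carrier → List Carrier → Carrier → List Carrier × Carrier
  divideByLinear c []        r = [] , c + r
  divideByLinear c (c′ ∷ cs) r with divideByLinear c′ cs r
  ... | q , ρ = ρ ∷ q , c + r * ρ

  length-quotient : ∀ c cs r → length (proj₁ (divideByLinear c cs r)) ≡ length cs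
  length-quotient c []        r = refl
  length-quotient c (c′ ∷ cs) r = cong suc (length-quotient c′ cs r)

  division-correct : ∀ c cs r x → let (q , ρ) = divideByLinear c cs r in
                     evalMonic (c ∷ cs) x ≡ (x - r) * evalMonic q x + ρ
  division-correct c []        r x = solve 3 (λ c x r → c :+ x :* :1 := (x :- r) :* :1 :+ (c :+ r)) refl c x r
  division-correct c (c′ ∷ cs) r x with divideByLinear c′ cs r | division-correct c′ cs r x
  ... | q , ρ | c′∷cs≡ = begin
    c + x * evalMonic (c′ ∷ cs) x        ≡⟨ cong (λ w → c + x * w) c′∷cs≡ ⟩
    c + x * ((x - r) * Q + ρ)
      ≡⟨ solve 5 (λ c x r Q ρ → c :+ x :* ((x :- r) :* Q :+ ρ) := (x :- r) :* (ρ :+ x :* Q) :+ (c :+ r :* ρ)) refl c x r Q ρ ⟩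
    (x - r) * (ρ + x * Q) + (c + r * ρ)  ∎
    where
    Q : Carrier
    Q = evalMonic q x

  Root : List Carrier → Carrier → Set
  Root cs r = evalMonic cs r ≡ 0#

  root-count : ∀ cs (rs : List Carrier) → Unique rs → All (Root cs) rs → length rs ≤ length cs
  root-count cs       []       _                _                = z≤n
  root-count []       (r ∷ rs) _                (1≡0 ∷ _)        = contradiction 1≡0 1≢0
  root-count (c ∷ cs) (r ∷ rs) (r∉rs ∷ rs-unique) (root-r ∷ roots) =
    subst (λ k → suc (length rs) ≤ suc k) (length-quotient c cs r)
      (s≤s (root-count q rs rs-unique (All.zipWith root-of-quotient (r∉rs , roots))))
    where
    q : List Carrier
    q = proj₁ (divideByLinear c cs r)
    ρ : Carrier
    ρ = proj₂ (divideByLinear c cs r)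
    ρ≡0 : ρ ≡ 0#
    ρ≡0 = begin
      ρ                                ≡⟨ solve 3 (λ r Q ρ → ρ := (r :- r) :* Q :+ ρ) refl r (evalMonic q r) ρ ⟩
      (r - r) * evalMonic q r + ρ      ≡⟨ division-correct c cs r r ⟨
      evalMonic (c ∷ cs) r             ≡⟨ root-r ⟩
      0#                               ∎
    root-of-quotient : ∀ {r′} → r ≢ r′ × Root (c ∷ cs) r′ → Root q r′
    root-of-quotient {r′} (r≢r′ , root-r′) =
      [ (λ r′-r≡0 → contradiction (sym (x-y≡0⇒x≡y _ _ r′-r≡0)) r≢r′) , (λ q≡0 → q≡0) ]′
        (x*y≡0⇒x≡0⊎y≡0 (begin
          (r′ - r) * evalMonic q r′        ≡⟨ +-identityʳ _ ⟨
          (r′ - r) * evalMonic q r′ + 0#   ≡⟨ cong (λ w → (r′ - r) * evalMonic q r′ + w) ρ≡0 ⟨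
          (r′ - r) * evalMonic q r′ + ρ    ≡⟨ division-correct c cs r r′ ⟨
          evalMonic (c ∷ cs) r′            ≡⟨ root-r′ ⟩
          0#                               ∎))

  evalMonic-replicate : ∀ m x → evalMonic (replicate m 0#) x ≡ x ^ m
  evalMonic-replicate zero    x = refl
  evalMonic-replicate (suc m) x = trans (+-identityˡ _) (cong (x *_) (evalMonic-replicate m x))

  powPlus : ℕ → Carrier → List Carrier
  powPlus m c = c ∷ replicate m 0#

  eval-powPlus : ∀ m c x → evalMonic (powPlus m c) x ≡ x ^ suc m + c
  eval-powPlus m c x = trans (cong (λ w → c + x * w) (evalMonic-replicate m x)) (+-comm c _)

  length-powPlus : ∀ m c → length (powPlus m c) ≡ suc m
  length-powPlus m c = cong suc (List.length-replicate m)

  powMinusX : ℕ → List Carrier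
  powMinusX j = 0# ∷ - 1# ∷ replicate j 0#

  eval-powMinusX : ∀ j x → evalMonic (powMinusX j) x ≡ x ^ suc (suc j) - x
  eval-powMinusX j x = begin
    0# + x * (- 1# + x * evalMonic (replicate j 0#) x) ≡⟨ cong (λ w → 0# + x * (- 1# + x * w)) (evalMonic-replicate j x) ⟩
    0# + x * (- 1# + x * x ^ j)
      ≡⟨ solve 2 (λ x w → :0 :+ x :* (:- :1 :+ x :* w) := x :* (x :* w) :- x) refl x (x ^ j) ⟩
    x * (x * x ^ j) - x                                 ∎

  length-powMinusX : ∀ j → length (powMinusX j) ≡ suc (suc j)
  length-powMinusX j = cong (λ k → suc (suc k)) (List.length-replicate j)

module EulerCriterion {n : ℕ} (F : FiniteField n) (m : ℕ) (n≡1+2m : n ≡ suc (2 ℕ.* m)) where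
  open FieldProperties F
  open FiniteFieldProperties F
  open MonicPolynomials F
  open ≡-Reasoning

  x^[2m]≡1 : ∀ x → ¬ x ≡ 0# → x ^ (2 ℕ.* m) ≡ 1#
  x^[2m]≡1 x x≢0 = trans (cong (λ k → x ^ (k ℕ.∸ 1)) (sym n≡1+2m)) (fermat x x≢0)

  square⇒^m≡1 : ∀ {c} → ¬ c ≡ 0# → IsSquare c → c ^ m ≡ 1#
  square⇒^m≡1 {c} c≢0 (u , u*u≡c) = begin
    c ^ m          ≡⟨ cong (_^ m) (trans (sym u*u≡c) (sym (x^2≡x*x u))) ⟩
    (u ^ 2) ^ m    ≡⟨ ^-*-assoc u 2 m ⟩
    u ^ (2 ℕ.* m)  ≡⟨ x^[2m]≡1 u u≢0 ⟩
    1#             ∎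
    where
    u≢0 : ¬ u ≡ 0#
    u≢0 u≡0 = c≢0 (trans (sym u*u≡c) (trans (cong (_* u) u≡0) (zeroˡ u)))

  m≡1+[m∸1] : m ≡ suc (m ℕ.∸ 1)
  m≡1+[m∸1] = positive m n≡1+2m
    where
    singleton : ∀ {k} → k ≡ 1 → (i j : Fin k) → i ≡ j
    singleton refl Fin.zero Fin.zero = refl
    positive : ∀ k → n ≡ suc (2 ℕ.* k) → k ≡ suc (k ℕ.∸ 1)
    positive (suc k) _   = refl
    positive zero    n≡1 = contradiction
      (trans (sym (element-index 0#)) (trans (cong element (singleton n≡1 _ _)) (element-index 1#))) 0≢1

  -- If c were not a square, squaring would map the n elements at most two-to-one
  -- into 0 and the roots of X^m - 1 other than c, of which there are fewer than m.
  ^m≡1⇒square : ∀ {c} → ¬ c ≡ 0# → c ^ m ≡ 1# → IsSquare c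
  ^m≡1⇒square {c} c≢0 c^m≡1 with isSquare? c
  ... | yes c-square = c-square
  ... | no c-nonSquare = contradiction (ℕ.≤-trans (s≤s n≤2m) (ℕ.≤-reflexive (sym n≡1+2m))) (ℕ.<-irrefl refl)
    where
    OtherRoot : Carrier → Set
    OtherRoot z = z ^ m ≡ 1# × ¬ z ≡ c
    otherRoot? : Decidable OtherRoot
    otherRoot? z = ((z ^ m) ≟ 1#) ×-dec ¬? (z ≟ c)
    others : List Carrier
    others = filter otherRoot? elements
    square∈ : ∀ x → x ∈ elements → x * x ∈ 0# ∷ others
    square∈ x _ with x ≟ 0#
    ... | yes x≡0 = here (trans (cong (λ z → z * z) x≡0) (zeroˡ 0#))
    ... | no x≢0  = there (∈.∈-filter⁺ otherRoot? (∈-elements (x * x))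
                      (square⇒^m≡1 (*-≢0 x≢0 x≢0) (x , refl) , λ x*x≡c → c-nonSquare (x , x*x≡c)))
    fibre≤2 : ∀ y (zs : List Carrier) → Unique zs → All (λ z → z * z ≡ y) zs → length zs ≤ 2
    fibre≤2 y zs zs-unique zs² = root-count (powPlus 1 (- y)) zs zs-unique (All.map root zs²)
      where
      root : ∀ {z} → z * z ≡ y → Root (powPlus 1 (- y)) z
      root {z} z²≡y = trans (eval-powPlus 1 (- y) z) (trans (cong (_- y) (trans (x^2≡x*x z) z²≡y)) (-‿inverseʳ y))
    n≤2[1+others] : n ≤ 2 ℕ.* suc (length others)
    n≤2[1+others] = subst (_≤ 2 ℕ.* suc (length others)) length-elements
      (length≤k*length-image (λ z → z * z) 2 _≟_ fibre≤2 (0# ∷ others) elements elements-unique square∈)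
    1+others≤m : suc (length others) ≤ m
    1+others≤m = subst (suc (length others) ≤_) (trans (length-powPlus (m ℕ.∸ 1) (- 1#)) (sym m≡1+[m∸1]))
      (root-count (powPlus (m ℕ.∸ 1) (- 1#)) (c ∷ others) c∷others-unique
        (All.map root (c^m≡1 ∷ All.map proj₁ (all-filter otherRoot? elements))))
      where
      c∷others-unique : Unique (c ∷ others)
      c∷others-unique = All.map (λ other c≡z → proj₂ other (sym c≡z)) (all-filter otherRoot? elements)
                      ∷ Unique.filter⁺ otherRoot? elements-unique
      root : ∀ {z} → z ^ m ≡ 1# → Root (powPlus (m ℕ.∸ 1) (- 1#)) z
      root {z} z^m≡1 = trans (eval-powPlus (m ℕ.∸ 1) (- 1#) z)
        (trans (cong (λ k → z ^ k - 1#) (sym m≡1+[m∸1])) (trans (cong (_- 1#) z^m≡1) (-‿inverseʳ 1#)))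
    n≤2m : n ≤ 2 ℕ.* m
    n≤2m = ℕ.≤-trans n≤2[1+others] (ℕ.*-monoʳ-≤ 2 1+others≤m)

module FreshmansDream {n : ℕ} (F : FiniteField n) (p : ℕ) (p-prime : Prime p) where
  open FieldProperties F
  open ≡-Reasoning
  private
    semiring : Semiring 0ℓ 0ℓ
    semiring = CommutativeRing.semiring commutativeRing
    module ∑ = SemiringSum semiring
    module Binom = Binomial (CommutativeRing.commutativeSemiring commutativeRing)
  open SemiringMult semiring using (×-assocˡ; ×-assoc-*; ×-homo-1)
  open SemiringExp semiring using () renaming (_^_ to _^ˢ_)

  module _ (characteristic : fromℕ p ≡ 0#) where

    ^ˢ≡^ : ∀ x k → x ^ˢ k ≡ x ^ k
    ^ˢ≡^ x zero    = refl
    ^ˢ≡^ x (suc k) = cong (x *_) (^ˢ≡^ x k)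

    p*c·z≡0 : ∀ c z → (p ℕ.* c) · z ≡ 0#
    p*c·z≡0 c z = begin
      (p ℕ.* c) · z          ≡⟨ cong (_· z) (ℕ.*-comm p c) ⟩
      (c ℕ.* p) · z          ≡⟨ ×-assocˡ z c p ⟨
      c · (p · z)            ≡⟨ cong (c ·_) (trans (×-assoc-* p 1# z) (cong (p ·_) (*-identityˡ z))) ⟨
      c · (fromℕ p * z)      ≡⟨ cong (λ w → c · (w * z)) characteristic ⟩
      c · (0# * z)           ≡⟨ cong (c ·_) (zeroˡ z) ⟩
      c · 0#                 ≡⟨ c·0≡0 c ⟩
      0#                     ∎
      where
      c·0≡0 : ∀ c → c · 0# ≡ 0#
      c·0≡0 zero    = refl
      c·0≡0 (suc c) = trans (+-identityˡ _) (c·0≡0 c)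

    ∑≡0 : ∀ {m} (f : Fin m → Carrier) → (∀ i → f i ≡ 0#) → ∑.sum f ≡ 0#
    ∑≡0 {zero}  f f≡0 = refl
    ∑≡0 {suc m} f f≡0 = trans (cong₂ _+_ (f≡0 zero) (∑≡0 (f ∘ suc) (f≡0 ∘ suc))) (+-identityˡ 0#)

    +-^-prime : ∀ x y → (x + y) ^ p ≡ x ^ p + y ^ p
    +-^-prime x y = go p p-prime ≡.refl
      where
      go : ∀ p′ → Prime p′ → p′ ≡ p → (x + y) ^ p′ ≡ x ^ p′ + y ^ p′
      go (suc p′) _ refl = begin
        (x + y) ^ suc p′                                ≡⟨ ^ˢ≡^ (x + y) (suc p′) ⟨
        (x + y) ^ˢ suc p′                               ≡⟨ Binom.theorem (suc p′) x y ⟩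
        T zero + ∑.sum (λ i → T (suc i))                ≡⟨ cong (T zero +_) (∑.sum-init-last (λ i → T (suc i))) ⟩
        T zero + (∑.sum (λ i → T (suc (inject₁ i))) + T (suc (Fin.fromℕ p′)))
                                                        ≡⟨ cong (λ w → T zero + (w + T (suc (Fin.fromℕ p′)))) (∑≡0 _ middle≡0) ⟩
        T zero + (0# + T (suc (Fin.fromℕ p′)))          ≡⟨ cong₂ (λ u v → u + (0# + v)) first last ⟩
        y ^ suc p′ + (0# + x ^ suc p′)                  ≡⟨ solve 2 (λ x y → y :+ (:0 :+ x) := x :+ y) refl (x ^ suc p′) (y ^ suc p′) ⟩
        x ^ suc p′ + y ^ suc p′                         ∎
        where
        T : Fin (suc (suc p′)) → Carrier
        T = Binom.binomialTerm x y (suc p′)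
        first : T zero ≡ y ^ suc p′
        first = trans (×-homo-1 _) (trans (*-identityˡ _) (^ˢ≡^ y (suc p′)))
        last : T (suc (Fin.fromℕ p′)) ≡ x ^ suc p′
        last = begin
          (suc p′ C suc (toℕ (Fin.fromℕ p′))) · (x ^ˢ suc (toℕ (Fin.fromℕ p′)) * y ^ˢ (p′ ℕ.∸ toℕ (Fin.fromℕ p′)))
            ≡⟨ cong (λ k → (suc p′ C suc k) · (x ^ˢ suc k * y ^ˢ (p′ ℕ.∸ k))) (Fin.toℕ-fromℕ p′) ⟩
          (suc p′ C suc p′) · (x ^ˢ suc p′ * y ^ˢ (p′ ℕ.∸ p′))
            ≡⟨ cong₂ _·_ (nCn≡1 (suc p′)) (cong (λ k → x ^ˢ suc p′ * y ^ˢ k) (ℕ.n∸n≡0 p′)) ⟩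
          1 · (x ^ˢ suc p′ * 1#)                       ≡⟨ ×-homo-1 _ ⟩
          x ^ˢ suc p′ * 1#                             ≡⟨ *-identityʳ _ ⟩
          x ^ˢ suc p′                                  ≡⟨ ^ˢ≡^ x (suc p′) ⟩
          x ^ suc p′                                   ∎
        middle≡0 : ∀ i → T (suc (inject₁ i)) ≡ 0#
        middle≡0 i with p∣pCk (suc p′) (suc (toℕ (inject₁ i))) p-prime (s≤s z≤n)
                          (s≤s (subst (ℕ._< p′) (sym (Fin.toℕ-inject₁ i)) (Fin.toℕ<n i)))
        ... | divides c pCk≡c*p = trans (cong (_· Binom.binomial x y (suc p′) (suc (inject₁ i))) (trans pCk≡c*p (ℕ.*-comm c (suc p′))))
                                         (p*c·z≡0 c _)

    +-^-prime^k : ∀ k x y → (x + y) ^ (p ℕ.^ k) ≡ x ^ (p ℕ.^ k) + y ^ (p ℕ.^ k)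
    +-^-prime^k zero    x y = trans (*-identityʳ _) (sym (cong₂ _+_ (*-identityʳ x) (*-identityʳ y)))
    +-^-prime^k (suc k) x y = begin
      (x + y) ^ (p ℕ.* p ℕ.^ k)                    ≡⟨ ^-*-assoc (x + y) p (p ℕ.^ k) ⟨
      ((x + y) ^ p) ^ (p ℕ.^ k)                    ≡⟨ cong (_^ (p ℕ.^ k)) (+-^-prime x y) ⟩
      (x ^ p + y ^ p) ^ (p ℕ.^ k)                  ≡⟨ +-^-prime^k k (x ^ p) (y ^ p) ⟩
      (x ^ p) ^ (p ℕ.^ k) + (y ^ p) ^ (p ℕ.^ k)    ≡⟨ cong₂ _+_ (^-*-assoc x p (p ℕ.^ k)) (^-*-assoc y p (p ℕ.^ k)) ⟩
      x ^ (p ℕ.* p ℕ.^ k) + y ^ (p ℕ.* p ℕ.^ k)    ∎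

-- In a field of order n = 1 + 2m with m = 2^s r, r odd, an element y with y^(2^j) = -1
-- has order 2^(j+1) times an odd number: it is a square exactly when j < s.
module SquareTower {n : ℕ} (F : FiniteField n) (m : ℕ) (n≡1+2m : n ≡ suc (2 ℕ.* m))
                   (s r : ℕ) (m≡2^s*r : m ≡ 2 ℕ.^ s ℕ.* r) (r-odd : ¬ 2 ∣ r) where
  open FieldProperties F
  open FiniteFieldProperties F using (1+1≢0)
  open EulerCriterion F m n≡1+2m
  open ≡-Reasoning

  y^2^j≡-1⇒y≢0 : ∀ {y} j → y ^ (2 ℕ.^ j) ≡ - 1# → ¬ y ≡ 0#
  y^2^j≡-1⇒y≢0 {y} j y^2^j≡-1 y≡0 = -‿≢0 1≢0 (begin
    - 1#                     ≡⟨ y^2^j≡-1 ⟨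
    y ^ (2 ℕ.^ j)            ≡⟨ cong (λ z → z ^ (2 ℕ.^ j)) y≡0 ⟩
    0# ^ (2 ℕ.^ j)           ≡⟨ cong (0# ^_) (proj₂ 2^j≡1+) ⟩
    0# ^ suc (proj₁ 2^j≡1+)  ≡⟨ zeroˡ _ ⟩
    0#                       ∎)
    where
    2^j≡1+ : ∃ λ i → 2 ℕ.^ j ≡ suc i
    2^j≡1+ = _ , sym (ℕ.suc-pred (2 ℕ.^ j) {{ℕ.>-nonZero (ℕ.m^n>0 2 j)}})

  tower-square : ∀ {y} j → y ^ (2 ℕ.^ j) ≡ - 1# → j < s → IsSquare y
  tower-square {y} j y^2^j≡-1 j<s = ^m≡1⇒square (y^2^j≡-1⇒y≢0 j y^2^j≡-1) (begin
    y ^ m                               ≡⟨ cong (y ^_) m≡ ⟩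
    y ^ (2 ℕ.^ j ℕ.* (2 ℕ.* w))         ≡⟨ ^-*-assoc y (2 ℕ.^ j) (2 ℕ.* w) ⟨
    (y ^ (2 ℕ.^ j)) ^ (2 ℕ.* w)         ≡⟨ cong (_^ (2 ℕ.* w)) y^2^j≡-1 ⟩
    (- 1#) ^ (2 ℕ.* w)                  ≡⟨ -1^[2k]≡1 w ⟩
    1#                                  ∎)
    where
    w : ℕ
    w = 2 ℕ.^ (s ℕ.∸ suc j) ℕ.* r
    m≡ : m ≡ 2 ℕ.^ j ℕ.* (2 ℕ.* w)
    m≡ = trans m≡2^s*r (2^s*r≡2^j*[2*w] r j<s)

  tower-nonSquare : ∀ {y} j → y ^ (2 ℕ.^ j) ≡ - 1# → j ≡ s → ¬ IsSquare y
  tower-nonSquare {y} j y^2^j≡-1 refl y-square = -1≢1 (1+1≢0 m n≡1+2m) (begin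
    - 1#                        ≡⟨ -1^[1+2k]≡-1 r′ ⟨
    (- 1#) ^ suc (2 ℕ.* r′)     ≡⟨ cong ((- 1#) ^_) r≡1+2r′ ⟨
    (- 1#) ^ r                  ≡⟨ cong (_^ r) y^2^j≡-1 ⟨
    (y ^ (2 ℕ.^ j)) ^ r         ≡⟨ ^-*-assoc y (2 ℕ.^ j) r ⟩
    y ^ (2 ℕ.^ j ℕ.* r)         ≡⟨ cong (y ^_) m≡2^s*r ⟨
    y ^ m                       ≡⟨ square⇒^m≡1 (y^2^j≡-1⇒y≢0 j y^2^j≡-1) y-square ⟩
    1#                          ∎)
    where
    r′ : ℕ
    r′ = proj₁ (¬2∣⇒≡1+2* r r-odd)
    r≡1+2r′ : r ≡ suc (2 ℕ.* r′)
    r≡1+2r′ = proj₂ (¬2∣⇒≡1+2* r r-odd)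

module EmbeddingProperties {q q′ : ℕ} {K : FiniteField q} {L : FiniteField q′} (E : FieldEmbedding K L) where
  private
    module K = FieldProperties K
    module L = FieldProperties L
  open FieldEmbedding E public
  open ≡-Reasoning

  ι-0 : ι K.0# ≡ L.0#
  ι-0 = L.x+x≡x⇒x≡0 _ (trans (sym (ι-+ K.0# K.0#)) (cong ι (K.+-identityˡ K.0#)))

  ι-neg : ∀ x → ι (K.- x) ≡ L.- ι x
  ι-neg x = L.x+y≡0⇒y≡-x _ _ (trans (sym (ι-+ x (K.- x))) (trans (cong ι (K.-‿inverseʳ x)) ι-0))

  ι-sub : ∀ x y → ι (x K.- y) ≡ ι x L.- ι y
  ι-sub x y = trans (ι-+ x (K.- y)) (cong (ι x L.+_) (ι-neg y))

  ι-^ : ∀ x k → ι (x K.^ k) ≡ ι x L.^ k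
  ι-^ x zero    = ι-1
  ι-^ x (suc k) = trans (ι-* x (x K.^ k)) (cong (ι x L.*_) (ι-^ x k))

  ι-inv : ∀ x (x≢0 : ¬ x ≡ K.0#) → ι (K.inv x x≢0) L.* ι x ≡ L.1#
  ι-inv x x≢0 = trans (sym (ι-* _ _)) (trans (cong ι (K.*-inverseˡ x x≢0)) ι-1)

  ι-≢0 : ∀ {x} → ¬ x ≡ K.0# → ¬ ι x ≡ L.0#
  ι-≢0 {x} x≢0 ιx≡0 = L.1≢0 (begin
    L.1#                          ≡⟨ ι-inv x x≢0 ⟨
    ι (K.inv x x≢0) L.* ι x       ≡⟨ cong (ι (K.inv x x≢0) L.*_) ιx≡0 ⟩
    ι (K.inv x x≢0) L.* L.0#      ≡⟨ L.zeroʳ _ ⟩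
    L.0#                          ∎)

  ι-injective : ∀ {x y} → ι x ≡ ι y → x ≡ y
  ι-injective {x} {y} ιx≡ιy with (x K.- y) K.≟ K.0#
  ... | yes x-y≡0 = K.x-y≡0⇒x≡y x y x-y≡0
  ... | no x-y≢0  = contradiction (trans (ι-sub x y) (L.x≡y⇒x-y≡0 ιx≡ιy)) (ι-≢0 x-y≢0)

module QuadraticExtension {q p k : ℕ} (p-prime : Prime p) (q≡p^k : q ≡ p ℕ.^ k)
                          (K : FiniteField q) (L : FiniteField (q ℕ.* q)) (E : FieldEmbedding K L) where
  module K where
    open FieldProperties K public
    open FiniteFieldProperties K public
  module L where
    open FieldProperties L public
    open FiniteFieldProperties L public
    open MonicPolynomials L public
  open EmbeddingProperties E public
  open ≡-Reasoning

  fromℕ-^ : ∀ j → L.fromℕ (p ℕ.^ j) ≡ L.fromℕ p L.^ j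
  fromℕ-^ zero    = L.+-identityʳ L.1#
  fromℕ-^ (suc j) = trans (L.fromℕ-* p (p ℕ.^ j)) (cong (L.fromℕ p L.*_) (fromℕ-^ j))

  characteristic-L : L.fromℕ p ≡ L.0#
  characteristic-L = L.x^n≡0⇒x≡0 k (L.x*x≡0⇒x≡0 (begin
    L.fromℕ p L.^ k L.* L.fromℕ p L.^ k   ≡⟨ cong₂ L._*_ (fromℕ-^ k) (fromℕ-^ k) ⟨
    L.fromℕ (p ℕ.^ k) L.* L.fromℕ (p ℕ.^ k) ≡⟨ L.fromℕ-* (p ℕ.^ k) (p ℕ.^ k) ⟨
    L.fromℕ (p ℕ.^ k ℕ.* p ℕ.^ k)         ≡⟨ cong (λ z → L.fromℕ (z ℕ.* z)) q≡p^k ⟨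
    L.fromℕ (q ℕ.* q)                     ≡⟨ L.characteristic ⟩
    L.0#                                  ∎))

  σ : L.Carrier → L.Carrier
  σ Z = Z L.^ q

  σ-+ : ∀ Z W → σ (Z L.+ W) ≡ σ Z L.+ σ W
  σ-+ Z W = subst (λ j → (Z L.+ W) L.^ j ≡ Z L.^ j L.+ W L.^ j) (sym q≡p^k)
                  (FreshmansDream.+-^-prime^k L p p-prime characteristic-L k Z W)

  σ-* : ∀ Z W → σ (Z L.* W) ≡ σ Z L.* σ W
  σ-* Z W = L.^-distribʳ-* Z W q

  σ-involutive : ∀ Z → σ (σ Z) ≡ Z
  σ-involutive Z = trans (L.^-*-assoc Z q q) (L.x^n≡x Z)

  σ-ι : ∀ x → σ (ι x) ≡ ι x
  σ-ι x = trans (sym (ι-^ x q)) (cong ι (K.x^n≡x x))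

  InK : L.Carrier → Set
  InK Z = ∃ λ x → ι x ≡ Z

  inK? : ∀ Z → Dec (InK Z)
  inK? Z with Fin.any? (λ i → ι (K.element i) L.≟ Z)
  ... | yes (i , ιeᵢ≡Z) = yes (K.element i , ιeᵢ≡Z)
  ... | no ∄i           = no λ { (x , ιx≡Z) → ∄i (K.index x , trans (cong ι (K.element-index x)) ιx≡Z) }

  -- The q elements of K and Z itself would be q + 1 roots of X ^ q - X.
  σ-fixed⇒InK : ∀ Z → σ Z ≡ Z → InK Z
  σ-fixed⇒InK Z σZ≡Z with inK? Z
  ... | yes Z∈K = Z∈K
  ... | no Z∉K  = contradiction (subst₂ _≤_ (cong suc (trans (List.length-map ι K.elements) K.length-elements))
                                              (trans (L.length-powMinusX j) (sym K.n≡2+[n∸2]))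
                                              (L.root-count (L.powMinusX j) roots unique (All.map root fixed)))
                                 (ℕ.<-irrefl refl)
    where
    j : ℕ
    j = q ℕ.∸ 2
    roots : List L.Carrier
    roots = Z ∷ map ι K.elements
    unique : Unique roots
    unique = All.tabulate (λ {W} W∈ιK Z≡W → Z∉K (image W∈ιK Z≡W)) ∷ Unique.map⁺ ι-injective K.elements-unique
      where
      image : ∀ {W} → W ∈ map ι K.elements → Z ≡ W → InK Z
      image W∈ιK Z≡W with ∈.∈-map⁻ ι W∈ιK
      ... | x , _ , W≡ιx = x , sym (trans Z≡W W≡ιx)
    fixed : All (λ W → σ W ≡ W) roots
    fixed = σZ≡Z ∷ All.tabulate σ-fixes
      where
      σ-fixes : ∀ {W} → W ∈ map ι K.elements → σ W ≡ W
      σ-fixes W∈ιK with ∈.∈-map⁻ ι W∈ιK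
      ... | x , _ , refl = σ-ι x
    root : ∀ {W} → σ W ≡ W → L.Root (L.powMinusX j) W
    root {W} σW≡W = trans (L.eval-powMinusX j W) (L.x≡y⇒x-y≡0 (trans (cong (W L.^_) (sym K.n≡2+[n∸2])) σW≡W))

  norm-InK : ∀ Y → InK (σ Y L.* Y)
  norm-InK Y = σ-fixed⇒InK _ (trans (σ-* (σ Y) Y) (trans (cong (L._* σ Y) (σ-involutive Y)) (L.*-comm Y (σ Y))))

module OddQuadraticExtension {q p k : ℕ} (p-prime : Prime p) (q≡p^k : q ≡ p ℕ.^ k)
                             (K : FiniteField q) (L : FiniteField (q ℕ.* q)) (E : FieldEmbedding K L)
                             (m : ℕ) (q≡1+2m : q ≡ suc (2 ℕ.* m)) where
  open QuadraticExtension {k = k} p-prime q≡p^k K L E public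
  open EulerCriterion K m q≡1+2m public
  open ≡-Reasoning

  2≢0ᴷ : ¬ K.1# K.+ K.1# ≡ K.0#
  2≢0ᴷ = K.1+1≢0 m q≡1+2m

  2≢0ᴸ : ¬ L.1# L.+ L.1# ≡ L.0#
  2≢0ᴸ 2≡0 = 2≢0ᴷ (ι-injective (trans (ι-+ K.1# K.1#) (trans (cong₂ L._+_ ι-1 ι-1) (trans 2≡0 (sym ι-0)))))

  -- q² = 1 + 2M with M = 2m(m + 1), and c ^ M = (c ^ 2m) ^ (m + 1) = 1.
  ι-square : ∀ c → L.IsSquare (ι c)
  ι-square c with c K.≟ K.0#
  ... | yes c≡0 = L.0# , trans (L.zeroˡ L.0#) (sym (trans (cong ι c≡0) ι-0))
  ... | no c≢0  = LEuler.^m≡1⇒square (ι-≢0 c≢0) (begin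
    ι c L.^ M                        ≡⟨ ι-^ c M ⟨
    ι (c K.^ M)                      ≡⟨ cong ι (K.^-*-assoc c (2 ℕ.* m) (suc m)) ⟨
    ι ((c K.^ (2 ℕ.* m)) K.^ suc m)  ≡⟨ cong (λ z → ι (z K.^ suc m)) (x^[2m]≡1 c c≢0) ⟩
    ι (K.1# K.^ suc m)               ≡⟨ cong ι (K.1^n≡1 (suc m)) ⟩
    ι K.1#                           ≡⟨ ι-1 ⟩
    L.1#                             ∎)
    where
    open import Data.Nat.Solver using (module +-*-Solver)
    open +-*-Solver
    M : ℕ
    M = 2 ℕ.* m ℕ.* suc m
    q²≡1+2M : q ℕ.* q ≡ suc (2 ℕ.* M)
    q²≡1+2M = trans (cong₂ ℕ._*_ q≡1+2m q≡1+2m)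
      (solve 1 (λ m → (con 1 :+ con 2 :* m) :* (con 1 :+ con 2 :* m) := con 1 :+ con 2 :* (con 2 :* m :* (con 1 :+ m))) refl m)
    module LEuler = EulerCriterion L M q²≡1+2M

-- Functional graphs

module _ {X : Set} (g : X → X) where

  iter-suc : ∀ m x → iter g (suc m) x ≡ iter g m (g x)
  iter-suc zero    x = refl
  iter-suc (suc m) x = cong g (iter-suc m x)

  iter-fixed : ∀ {y} → g y ≡ y → ∀ n → iter g n y ≡ y
  iter-fixed gy≡y zero    = refl
  iter-fixed gy≡y (suc n) = trans (cong g (iter-fixed gy≡y n)) gy≡y

  sameComponent-fixed : ∀ {x y} → g y ≡ y → SameComponent g x y → ∃ λ m → iter g m x ≡ y
  sameComponent-fixed gy≡y (m , n , gᵐx≡gⁿy) = m , trans gᵐx≡gⁿy (iter-fixed gy≡y n)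

  iter-reflects : (P : X → Set) → (∀ x → P (g x) → P x) → ∀ m x → P (iter g m x) → P x
  iter-reflects P closed zero    x Px       = Px
  iter-reflects P closed (suc m) x Pgᵐ⁺¹x = closed x (iter-reflects P closed m (g x) (subst P (iter-suc m x) Pgᵐ⁺¹x))

  component-fixed-⊆ : ∀ {y} (P : X → Set) → g y ≡ y → P y → (∀ x → P (g x) → P x) →
                      ∀ x → SameComponent g x y → P x
  component-fixed-⊆ P gy≡y Py closed x x~y with sameComponent-fixed gy≡y x~y
  ... | m , gᵐx≡y = iter-reflects P closed m x (subst P (sym gᵐx≡y) Py)

iter-commute : ∀ {V X : Set} {h : V → V} {g : X → X} (ψ : V → X) → (∀ v → ψ (h v) ≡ g (ψ v)) →
               ∀ n v → ψ (iter h n v) ≡ iter g n (ψ v)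
iter-commute ψ ψ∘h≡g∘ψ zero    v = refl
iter-commute {g = g} ψ ψ∘h≡g∘ψ (suc n) v = trans (ψ∘h≡g∘ψ _) (cong g (iter-commute ψ ψ∘h≡g∘ψ n v))

FunGraphIso-embed : ∀ {T V X : Set} {t : T → T} {h : V → V} {g : X → X} (ψ : V → X) (ρ : V) →
  Injective _≡_ _≡_ ψ → (∀ v → ψ (h v) ≡ g (ψ v)) →
  (∀ x → SameComponent g x (ψ ρ) → ∃ λ v → ψ v ≡ x) →
  FunGraphIso T t h (λ v → SameComponent h v ρ) →
  FunGraphIso T t g (λ x → SameComponent g x (ψ ρ))
FunGraphIso-embed {h = h} {g = g} ψ ρ ψ-injective ψ-hom component⊆image (φ , φ-injective , φ-image , φ-hom) =
  ψ ∘ φ , φ-injective ∘ ψ-injective , (λ x → mk⇔ (to x) (from x)) , λ t → trans (cong ψ (φ-hom t)) (ψ-hom (φ t))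
  where
  to : ∀ x → SameComponent g x (ψ ρ) → ∃ λ t → ψ (φ t) ≡ x
  to x x~ψρ with component⊆image x x~ψρ | x~ψρ
  ... | v , refl | m , n , gᵐψv≡gⁿψρ with Equivalence.to (φ-image v)
        (m , n , ψ-injective (trans (iter-commute ψ ψ-hom m v) (trans gᵐψv≡gⁿψρ (sym (iter-commute ψ ψ-hom n ρ)))))
  ...   | t , φt≡v = t , cong ψ φt≡v
  from : ∀ x → (∃ λ t → ψ (φ t) ≡ x) → SameComponent g x (ψ ρ)
  from x (t , refl) with Equivalence.from (φ-image (φ t)) (t , refl)
  ... | m , n , hᵐφt≡hⁿρ = m , n , trans (sym (iter-commute ψ ψ-hom m (φ t))) (trans (cong ψ hᵐφt≡hⁿρ) (iter-commute ψ ψ-hom n ρ))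

record TwoChildren {X : Set} (g : X → X) (child : X → Bool → X) (v : X) : Set where
  field
    child-edge        : ∀ β → g (child v β) ≡ v
    children-distinct : child v true ≢ child v false
    preimage-child    : ∀ x → g x ≡ v → ∃ λ β → x ≡ child v β

module CycTreeRecognition {X : Set} (g : X → X) (ρ P₁ : X) (child : X → Bool → X) (m : ℕ) (1≤m : 1 ≤ m)
  (gρ≡ρ : g ρ ≡ ρ) (gP₁≡ρ : g P₁ ≡ ρ) (P₁≢ρ : P₁ ≢ ρ) (preimage-ρ : ∀ x → g x ≡ ρ → x ≡ ρ ⊎ x ≡ P₁) where

  vertex : List Bool → X
  vertex []      = P₁
  vertex (β ∷ l) = child (vertex l) β

  module _ (inner : ∀ l → suc (length l) < m → TwoChildren g child (vertex l))
           (leaf : ∀ l → suc (length l) ≡ m → ∀ x → g x ≢ vertex l) where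
    open TwoChildren

    ψ : CycTree-V m → X
    ψ nothing        = ρ
    ψ (just (l , _)) = vertex l

    ψ-hom : ∀ v → ψ (CycTree-next m v) ≡ g (ψ v)
    ψ-hom nothing                = sym gρ≡ρ
    ψ-hom (just ([] , _))        = sym gP₁≡ρ
    ψ-hom (just (β ∷ l , 2+l≤m)) = sym (child-edge (inner l 2+l≤m) β)

    <m-pred : ∀ {k} → suc k < m → k < m
    <m-pred = ℕ.<-trans (ℕ.n<1+n _)

    vertex≢ρ : ∀ l → length l < m → vertex l ≢ ρ
    vertex≢ρ []      _        = P₁≢ρ
    vertex≢ρ (β ∷ l) 2+l≤m vβl≡ρ =
      vertex≢ρ l (<m-pred 2+l≤m) (trans (sym (child-edge (inner l 2+l≤m) β)) (trans (cong g vβl≡ρ) gρ≡ρ))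

    vertex-injective : ∀ l l′ → length l < m → length l′ < m → vertex l ≡ vertex l′ → l ≡ l′
    vertex-injective []      []        _ _ _ = refl
    vertex-injective []      (β ∷ l′) _ 2+l′≤m P₁≡vβl′ = contradiction
      (trans (sym (child-edge (inner l′ 2+l′≤m) β)) (trans (cong g (sym P₁≡vβl′)) gP₁≡ρ)) (vertex≢ρ l′ (<m-pred 2+l′≤m))
    vertex-injective (β ∷ l) []        2+l≤m _ vβl≡P₁ = contradiction
      (trans (sym (child-edge (inner l 2+l≤m) β)) (trans (cong g vβl≡P₁) gP₁≡ρ)) (vertex≢ρ l (<m-pred 2+l≤m))
    vertex-injective (β ∷ l) (β′ ∷ l′) 2+l≤m 2+l′≤m vβl≡vβ′l′
      with vertex-injective l l′ (<m-pred 2+l≤m) (<m-pred 2+l′≤m)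
             (trans (sym (child-edge (inner l 2+l≤m) β)) (trans (cong g vβl≡vβ′l′) (child-edge (inner l′ 2+l′≤m) β′)))
    ... | refl = cong (_∷ l) (child-injective β β′ vβl≡vβ′l′)
      where
      child-injective : ∀ β β′ → child (vertex l) β ≡ child (vertex l) β′ → β ≡ β′
      child-injective true  true  _ = refl
      child-injective false false _ = refl
      child-injective true  false e = contradiction e (children-distinct (inner l 2+l≤m))
      child-injective false true  e = contradiction (sym e) (children-distinct (inner l 2+l≤m))

    ψ-injective : Injective _≡_ _≡_ ψ
    ψ-injective {nothing}      {nothing}        _ = refl
    ψ-injective {nothing}      {just (l , l<m)} e = contradiction (sym e) (vertex≢ρ l l<m)
    ψ-injective {just (l , l<m)} {nothing}      e = contradiction e (vertex≢ρ l l<m)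
    ψ-injective {just (l , l<m)} {just (l′ , l′<m)} e with vertex-injective l l′ l<m l′<m e
    ... | refl = cong (λ p → just (l , p)) (ℕ.≤-irrelevant l<m l′<m)

    depth : ∀ l → length l < m → iter g (suc (length l)) (vertex l) ≡ ρ
    depth []      _     = gP₁≡ρ
    depth (β ∷ l) 2+l≤m = trans (iter-suc g (suc (length l)) _)
      (trans (cong (iter g (suc (length l))) (child-edge (inner l 2+l≤m) β)) (depth l (<m-pred 2+l≤m)))

    Image : X → Set
    Image x = ∃ λ v → ψ v ≡ x

    image-closed : ∀ x → Image (g x) → Image x
    image-closed x (nothing , ρ≡gx) with preimage-ρ x (sym ρ≡gx)
    ... | inj₁ x≡ρ  = nothing , sym x≡ρ
    ... | inj₂ x≡P₁ = just ([] , 1≤m) , sym x≡P₁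
    image-closed x (just (l , l<m) , vl≡gx) with suc (length l) ℕ.<? m
    ... | yes 2+l≤m = just (β ∷ l , 2+l≤m) , sym x≡child
      where
      β : Bool
      β = proj₁ (preimage-child (inner l 2+l≤m) x (sym vl≡gx))
      x≡child : x ≡ child (vertex l) β
      x≡child = proj₂ (preimage-child (inner l 2+l≤m) x (sym vl≡gx))
    ... | no 2+l≰m = contradiction (sym vl≡gx) (leaf l (ℕ.≤-antisym l<m (ℕ.≮⇒≥ 2+l≰m)) x)

    cycTree-iso : FunGraphIso (CycTree-V m) (CycTree-next m) g (λ x → SameComponent g x ρ)
    cycTree-iso = ψ , ψ-injective , (λ x → mk⇔ (component-fixed-⊆ g Image gρ≡ρ (nothing , refl) image-closed x) (inComponent x)) , ψ-hom
      where
      inComponent : ∀ x → Image x → SameComponent g x ρ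
      inComponent x (nothing , refl)        = 0 , 0 , refl
      inComponent x (just (l , l<m) , refl) = suc (length l) , 0 , depth l l<m

module Zstar4Recognition {X : Set} (g : X → X) (ρ : X) (leaf : Fin 3 → X)
  (gρ≡ρ : g ρ ≡ ρ) (leaf-edge : ∀ i → g (leaf i) ≡ ρ) (leaf≢ρ : ∀ i → leaf i ≢ ρ)
  (leaf-injective : Injective _≡_ _≡_ leaf)
  (preimage-ρ : ∀ x → g x ≡ ρ → x ≡ ρ ⊎ ∃ λ i → x ≡ leaf i)
  (no-preimage-leaf : ∀ i x → g x ≢ leaf i) where

  ψ : Zstar4-V → X
  ψ zero    = ρ
  ψ (suc i) = leaf i

  ψ-injective : Injective _≡_ _≡_ ψ
  ψ-injective {zero}  {zero}  _ = refl
  ψ-injective {zero}  {suc j} e = contradiction (sym e) (leaf≢ρ j)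
  ψ-injective {suc i} {zero}  e = contradiction e (leaf≢ρ i)
  ψ-injective {suc i} {suc j} e = cong suc (leaf-injective e)

  ψ-hom : ∀ v → ψ (Zstar4-next v) ≡ g (ψ v)
  ψ-hom zero    = sym gρ≡ρ
  ψ-hom (suc i) = sym (leaf-edge i)

  Image : X → Set
  Image x = ∃ λ v → ψ v ≡ x

  image-closed : ∀ x → Image (g x) → Image x
  image-closed x (zero , ρ≡gx) with preimage-ρ x (sym ρ≡gx)
  ... | inj₁ x≡ρ        = zero , sym x≡ρ
  ... | inj₂ (i , x≡ℓᵢ) = suc i , sym x≡ℓᵢ
  image-closed x (suc i , ℓᵢ≡gx) = contradiction (sym ℓᵢ≡gx) (no-preimage-leaf i x)

  zstar4-iso : FunGraphIso Zstar4-V Zstar4-next g (λ x → SameComponent g x ρ)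
  zstar4-iso = ψ , ψ-injective , (λ x → mk⇔ (component-fixed-⊆ g Image gρ≡ρ (zero , refl) image-closed x) (inComponent x)) , ψ-hom
    where
    inComponent : ∀ x → Image x → SameComponent g x ρ
    inComponent x (zero , refl)  = 0 , 0 , refl
    inComponent x (suc i , refl) = 1 , 0 , leaf-edge i

-- The map X ↦ X ^ (q + 1) + a X²

module Dynamics {q p k : ℕ} (p-prime : Prime p) (q≡p^k : q ≡ p ℕ.^ k)
                (K : FiniteField q) (L : FiniteField (q ℕ.* q)) (E : FieldEmbedding K L)
                (m : ℕ) (q≡1+2m : q ≡ suc (2 ℕ.* m))
                (a : FiniteField.Carrier K) (a≢0 : ¬ a ≡ FiniteField.0# K) (a≢1 : ¬ a ≡ FiniteField.1# K)
                (a≢-1 : ¬ a ≡ FiniteField.-_ K (FiniteField.1# K))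
                (χ[1-a²]≡1 : FiniteField.χ₂ K (FiniteField._-_ K (FiniteField.1# K) (FiniteField._^_ K a 2)) ≡ ℤ.+ 1) where
  open OddQuadraticExtension {k = k} p-prime q≡p^k K L E m q≡1+2m public
  open ≡-Reasoning

  f : L.Carrier → L.Carrier
  f = f-map K L E a

  fq : K.Carrier → K.Carrier
  fq = fq-map K L E a

  A : L.Carrier
  A = ι a

  f≡σX*X+AX² : ∀ X → f X ≡ σ X L.* X L.+ A L.* (X L.* X)
  f≡σX*X+AX² X = cong₂ L._+_ (trans (L.^-distribˡ-+-* X q 1) (cong (σ X L.*_) (L.*-identityʳ X)))
                              (cong (A L.*_) (L.x^2≡x*x X))

  f-ι : ∀ x → f (ι x) ≡ ι (fq x)
  f-ι x = begin
    f (ι x)                                  ≡⟨ f≡σX*X+AX² (ι x) ⟩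
    σ (ι x) L.* ι x L.+ A L.* (ι x L.* ι x)  ≡⟨ cong (λ w → w L.* ι x L.+ A L.* (ι x L.* ι x)) (σ-ι x) ⟩
    ι x L.* ι x L.+ A L.* (ι x L.* ι x)
      ≡⟨ L.solve 2 (λ X A → X L.:* X L.:+ A L.:* (X L.:* X) L.:= (A L.:+ L.:1) L.:* (X L.:* (X L.:* L.:1))) refl (ι x) A ⟩
    (A L.+ L.1#) L.* (ι x L.* (ι x L.* L.1#)) ≡⟨ cong₂ L._*_ (trans (ι-+ a K.1#) (cong (A L.+_) ι-1)) (ι-^ x 2) ⟨
    ι (a K.+ K.1#) L.* ι (x K.^ 2)           ≡⟨ ι-* _ _ ⟨
    ι (fq x)                                 ∎

  a+1≢0 : ¬ a K.+ K.1# ≡ K.0#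
  a+1≢0 a+1≡0 = a≢-1 (K.x+y≡0⇒y≡-x K.1# a (trans (K.+-comm K.1# a) a+1≡0))

  a-1≢0 : ¬ a K.- K.1# ≡ K.0#
  a-1≢0 a-1≡0 = a≢1 (K.x-y≡0⇒x≡y a K.1# a-1≡0)

  -- A square root outside F_q of an element c of F_q; these are the vertices attached to F_q.
  record PureRoot (Z : L.Carrier) (c : K.Carrier) : Set where
    field
      ∉K           : ¬ InK Z
      square       : Z L.* Z ≡ ι c
      c≢0          : ¬ c ≡ K.0#
      c-nonSquare  : ¬ K.IsSquare c
      σ-anti       : σ Z ≡ L.- Z

  pureRoot-∉K : ∀ {Z c} → ¬ InK Z → Z L.* Z ≡ ι c → PureRoot Z c
  pureRoot-∉K {Z} {c} Z∉K Z²≡ιc = record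
    { ∉K = Z∉K ; square = Z²≡ιc ; c≢0 = c≢0 ; c-nonSquare = c-nonSquare ; σ-anti = σ-anti }
    where
    c≢0 : ¬ c ≡ K.0#
    c≢0 c≡0 = Z∉K (K.0# , trans ι-0 (sym (L.x*x≡0⇒x≡0 (trans Z²≡ιc (trans (cong ι c≡0) ι-0)))))
    c-nonSquare : ¬ K.IsSquare c
    c-nonSquare (u , u²≡c) = [ (λ Z≡ιu → Z∉K (u , sym Z≡ιu)) , (λ Z≡-ιu → Z∉K (K.- u , trans (ι-neg u) (sym Z≡-ιu))) ]′
      (L.x*x≡y*y⇒x≡y⊎x≡-y (trans Z²≡ιc (trans (cong ι (sym u²≡c)) (ι-* u u))))
    σ-anti : σ Z ≡ L.- Z
    σ-anti = [ (λ σZ≡Z → contradiction (σ-fixed⇒InK Z σZ≡Z) Z∉K) , (λ σZ≡-Z → σZ≡-Z) ]′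
      (L.x*x≡y*y⇒x≡y⊎x≡-y (trans (sym (σ-* Z Z)) (trans (cong σ Z²≡ιc) (trans (σ-ι c) (sym Z²≡ιc)))))

  pureRoot-nonSquare : ∀ {Z c} → Z L.* Z ≡ ι c → ¬ K.IsSquare c → PureRoot Z c
  pureRoot-nonSquare {Z} {c} Z²≡ιc c-nonSquare = pureRoot-∉K Z∉K Z²≡ιc
    where
    Z∉K : ¬ InK Z
    Z∉K (z , refl) = c-nonSquare (z , ι-injective (trans (ι-* z z) Z²≡ιc))

  pureRoot≢0 : ∀ {Z c} → PureRoot Z c → ¬ Z ≡ L.0#
  pureRoot≢0 Z-pure Z≡0 = PureRoot.∉K Z-pure (K.0# , trans ι-0 (sym Z≡0))

  f-pureRoot : ∀ {Z c} → PureRoot Z c → f Z ≡ ι ((a K.- K.1#) K.* c)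
  f-pureRoot {Z} {c} Z-pure = begin
    f Z                                 ≡⟨ f≡σX*X+AX² Z ⟩
    σ Z L.* Z L.+ A L.* (Z L.* Z)       ≡⟨ cong (λ w → w L.* Z L.+ A L.* (Z L.* Z)) (PureRoot.σ-anti Z-pure) ⟩
    L.- Z L.* Z L.+ A L.* (Z L.* Z)
      ≡⟨ L.solve 2 (λ Z A → L.:- Z L.:* Z L.:+ A L.:* (Z L.:* Z) L.:= (A L.:- L.:1) L.:* (Z L.:* Z)) refl Z A ⟩
    (A L.- L.1#) L.* (Z L.* Z)          ≡⟨ cong₂ L._*_ (trans (ι-sub a K.1#) (cong (λ w → A L.- w) ι-1)) (sym (PureRoot.square Z-pure)) ⟨
    ι (a K.- K.1#) L.* ι c              ≡⟨ ι-* _ _ ⟨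
    ι ((a K.- K.1#) K.* c)              ∎

  preimage-ι : ∀ Z x → f Z ≡ ι x →
    (∃ λ z → ι z ≡ Z × (a K.+ K.1#) K.* (z K.* z) ≡ x) ⊎ (∃ λ c → PureRoot Z c × x ≡ (a K.- K.1#) K.* c)
  preimage-ι Z x fZ≡ιx with inK? Z
  ... | yes (z , refl) = inj₁ (z , refl , ι-injective (begin
    ι ((a K.+ K.1#) K.* (z K.* z))  ≡⟨ cong (λ w → ι ((a K.+ K.1#) K.* w)) (K.x^2≡x*x z) ⟨
    ι (fq z)                        ≡⟨ f-ι z ⟨
    f (ι z)                         ≡⟨ fZ≡ιx ⟩
    ι x                             ∎))
  ... | no Z∉K = inj₂ (c , Z-pure , ι-injective (trans (sym fZ≡ιx) (f-pureRoot Z-pure)))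
    where
    n₀ : K.Carrier
    n₀ = proj₁ (norm-InK Z)
    c : K.Carrier
    c = K.inv a a≢0 K.* (x K.- n₀)
    Z²≡ιc : Z L.* Z ≡ ι c
    Z²≡ιc = begin
      Z L.* Z                                         ≡⟨ L.*-identityˡ _ ⟨
      L.1# L.* (Z L.* Z)                              ≡⟨ cong (L._* (Z L.* Z)) (ι-inv a a≢0) ⟨
      (ι (K.inv a a≢0) L.* A) L.* (Z L.* Z)
        ≡⟨ L.solve 4 (λ i A N Z → (i L.:* A) L.:* (Z L.:* Z) L.:= i L.:* ((N L.:+ A L.:* (Z L.:* Z)) L.:- N)) refl (ι (K.inv a a≢0)) A (σ Z L.* Z) Z ⟩
      ι (K.inv a a≢0) L.* (f′ L.- σ Z L.* Z)
        ≡⟨ cong₂ (λ u v → ι (K.inv a a≢0) L.* (u L.- v)) (trans (sym (f≡σX*X+AX² Z)) fZ≡ιx) (sym (proj₂ (norm-InK Z))) ⟩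
      ι (K.inv a a≢0) L.* (ι x L.- ι n₀)              ≡⟨ cong (ι (K.inv a a≢0) L.*_) (ι-sub x n₀) ⟨
      ι (K.inv a a≢0) L.* ι (x K.- n₀)                ≡⟨ ι-* _ _ ⟨
      ι c                                             ∎
      where
      f′ : L.Carrier
      f′ = σ Z L.* Z L.+ A L.* (Z L.* Z)
    Z-pure : PureRoot Z c
    Z-pure = pureRoot-∉K Z∉K Z²≡ιc

  d : K.Carrier
  d = proj₁ (proj₂ (K.χ₂≡1⇒square _ χ[1-a²]≡1))

  d*d≡1-a*a : d K.* d ≡ K.1# K.- a K.* a
  d*d≡1-a*a = trans (proj₂ (proj₂ (K.χ₂≡1⇒square _ χ[1-a²]≡1))) (cong (λ w → K.1# K.- w) (K.x^2≡x*x a))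

  d≢0 : ¬ d ≡ K.0#
  d≢0 d≡0 = proj₁ (K.χ₂≡1⇒square _ χ[1-a²]≡1)
    (trans (cong (λ w → K.1# K.- w) (K.x^2≡x*x a)) (trans (sym d*d≡1-a*a) (trans (cong (K._* d) d≡0) (K.zeroˡ d))))

  A*T+Y≡ιe*Y⇒T≡ικ*Y : ∀ {T Y} e → A L.* T L.+ Y ≡ ι e L.* Y → T ≡ ι (K.inv a a≢0 K.* (e K.- K.1#)) L.* Y
  A*T+Y≡ιe*Y⇒T≡ικ*Y {T} {Y} e AT+Y≡eY = begin
    T                                      ≡⟨ L.*-identityˡ T ⟨
    L.1# L.* T                             ≡⟨ cong (L._* T) (ι-inv a a≢0) ⟨
    (ι a⁻¹ L.* A) L.* T
      ≡⟨ L.solve 4 (λ i A T Y → (i L.:* A) L.:* T L.:= i L.:* ((A L.:* T L.:+ Y) L.:- Y)) refl (ι a⁻¹) A T Y ⟩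
    ι a⁻¹ L.* ((A L.* T L.+ Y) L.- Y)      ≡⟨ cong (λ w → ι a⁻¹ L.* (w L.- Y)) AT+Y≡eY ⟩
    ι a⁻¹ L.* (ι e L.* Y L.- Y)
      ≡⟨ L.solve 3 (λ i e Y → i L.:* (e L.:* Y L.:- Y) L.:= (i L.:* (e L.:- L.:1)) L.:* Y) refl (ι a⁻¹) (ι e) Y ⟩
    (ι a⁻¹ L.* (ι e L.- L.1#)) L.* Y
      ≡⟨ cong (L._* Y) (trans (ι-* _ _) (cong (ι a⁻¹ L.*_) (trans (ι-sub e K.1#) (cong (λ w → ι e L.- w) ι-1)))) ⟨
    ι (a⁻¹ K.* (e K.- K.1#)) L.* Y         ∎
    where
    a⁻¹ : K.Carrier
    a⁻¹ = K.inv a a≢0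

  -- (A T + Y)² = A (A T² + 2 T Y + A Y²) + (1 - A²) Y², and 1 - a² = d².
  quadratic⇒proportional : ∀ T Y → A L.* (T L.* T) L.+ (T L.* Y L.+ T L.* Y) L.+ A L.* (Y L.* Y) ≡ L.0# →
                            ∃ λ κ → T ≡ ι κ L.* Y
  quadratic⇒proportional T Y quadratic≡0 =
    [ (λ AT+Y≡DY → _ , A*T+Y≡ιe*Y⇒T≡ικ*Y d AT+Y≡DY)
    , (λ AT+Y≡-DY → _ , A*T+Y≡ιe*Y⇒T≡ικ*Y (K.- d) (trans AT+Y≡-DY (trans (L.solve 2 (λ D Y → L.:- (D L.:* Y)
          L.:= (L.:- D) L.:* Y) refl D Y) (cong (L._* Y) (sym (ι-neg d)))))) ]′
    (L.x*x≡y*y⇒x≡y⊎x≡-y (begin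
      (A L.* T L.+ Y) L.* (A L.* T L.+ Y)
        ≡⟨ L.solve 3 (λ A T Y → (A L.:* T L.:+ Y) L.:* (A L.:* T L.:+ Y)
              L.:= A L.:* (A L.:* (T L.:* T) L.:+ (T L.:* Y L.:+ T L.:* Y) L.:+ A L.:* (Y L.:* Y)) L.:+ (L.:1 L.:- A L.:* A) L.:* (Y L.:* Y)) refl A T Y ⟩
      A L.* Q L.+ (L.1# L.- A L.* A) L.* (Y L.* Y)
        ≡⟨ cong₂ (λ u v → A L.* u L.+ v L.* (Y L.* Y)) quadratic≡0 (trans (cong₂ L._-_ (sym ι-1) (sym (ι-* a a))) (sym (ι-sub K.1# (a K.* a)))) ⟩
      A L.* L.0# L.+ ι (K.1# K.- a K.* a) L.* (Y L.* Y) ≡⟨ cong (λ w → A L.* L.0# L.+ ι w L.* (Y L.* Y)) d*d≡1-a*a ⟨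
      A L.* L.0# L.+ ι (d K.* d) L.* (Y L.* Y)  ≡⟨ cong (λ w → A L.* L.0# L.+ w L.* (Y L.* Y)) (ι-* d d) ⟩
      A L.* L.0# L.+ (D L.* D) L.* (Y L.* Y)
        ≡⟨ L.solve 3 (λ A D Y → A L.:* L.:0 L.:+ (D L.:* D) L.:* (Y L.:* Y) L.:= (D L.:* Y) L.:* (D L.:* Y)) refl A D Y ⟩
      (D L.* Y) L.* (D L.* Y)                  ∎))
    where
    D : L.Carrier
    D = ι d
    Q : L.Carrier
    Q = A L.* (T L.* T) L.+ (T L.* Y L.+ T L.* Y) L.+ A L.* (Y L.* Y)

  σ-proportional⇒κ²≡1 : ∀ {Y κ} → ¬ Y ≡ L.0# → σ Y ≡ ι κ L.* Y → κ K.* κ ≡ K.1#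
  σ-proportional⇒κ²≡1 {Y} {κ} Y≢0 σY≡κY = ι-injective (L.*-cancelʳ Y≢0 (begin
    ι (κ K.* κ) L.* Y              ≡⟨ cong (L._* Y) (ι-* κ κ) ⟩
    (ι κ L.* ι κ) L.* Y            ≡⟨ L.*-assoc _ _ _ ⟩
    ι κ L.* (ι κ L.* Y)            ≡⟨ cong (ι κ L.*_) σY≡κY ⟨
    ι κ L.* σ Y                    ≡⟨ cong (L._* σ Y) (σ-ι κ) ⟨
    σ (ι κ) L.* σ Y                ≡⟨ σ-* _ _ ⟨
    σ (ι κ L.* Y)                  ≡⟨ cong σ σY≡κY ⟨
    σ (σ Y)                        ≡⟨ σ-involutive Y ⟩
    Y                              ≡⟨ L.*-identityˡ Y ⟨
    L.1# L.* Y                     ≡⟨ cong (L._* Y) ι-1 ⟨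
    ι K.1# L.* Y                   ∎))

  -- X = N + A Y² and σ X = N + A (σ Y)² with N = σ Y · Y, so σ X + X = 0 is a quadratic relation.
  anti-invariant-image : ∀ Y → σ (f Y) ≡ L.- f Y →
    A L.* (σ Y L.* σ Y) L.+ (σ Y L.* Y L.+ σ Y L.* Y) L.+ A L.* (Y L.* Y) ≡ L.0#
  anti-invariant-image Y σX≡-X = begin
    A L.* (T L.* T) L.+ (T L.* Y L.+ T L.* Y) L.+ A L.* (Y L.* Y)
      ≡⟨ L.solve 3 (λ A T Y → A L.:* (T L.:* T) L.:+ (T L.:* Y L.:+ T L.:* Y) L.:+ A L.:* (Y L.:* Y)
            L.:= (T L.:* Y L.:+ A L.:* (T L.:* T)) L.:+ (T L.:* Y L.:+ A L.:* (Y L.:* Y))) refl A T Y ⟩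
    (N L.+ A L.* (T L.* T)) L.+ (N L.+ A L.* (Y L.* Y))             ≡⟨ cong₂ L._+_ σX≡ (sym (f≡σX*X+AX² Y)) ⟩
    σ (f Y) L.+ f Y                                                 ≡⟨ cong (L._+ f Y) σX≡-X ⟩
    L.- f Y L.+ f Y                                                 ≡⟨ L.-‿inverseˡ (f Y) ⟩
    L.0#                                                            ∎
    where
    T : L.Carrier
    T = σ Y
    N : L.Carrier
    N = T L.* Y
    σN≡N : σ N ≡ N
    σN≡N = trans (cong σ (sym (proj₂ (norm-InK Y)))) (trans (σ-ι _) (proj₂ (norm-InK Y)))
    σX≡ : N L.+ A L.* (T L.* T) ≡ σ (f Y)
    σX≡ = sym (begin
      σ (f Y)                                 ≡⟨ cong σ (f≡σX*X+AX² Y) ⟩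
      σ (N L.+ A L.* (Y L.* Y))               ≡⟨ σ-+ _ _ ⟩
      σ N L.+ σ (A L.* (Y L.* Y))             ≡⟨ cong₂ L._+_ σN≡N (trans (σ-* _ _) (cong₂ L._*_ (σ-ι a) (σ-* Y Y))) ⟩
      N L.+ A L.* (T L.* T)                   ∎)

  conjugate-negated⇒[1+1][A-1]Y²≡0 : ∀ Y → σ Y ≡ L.- Y →
    A L.* (σ Y L.* σ Y) L.+ (σ Y L.* Y L.+ σ Y L.* Y) L.+ A L.* (Y L.* Y) ≡ L.0# →
    ((L.1# L.+ L.1#) L.* (A L.- L.1#)) L.* (Y L.* Y) ≡ L.0#
  conjugate-negated⇒[1+1][A-1]Y²≡0 Y σY≡-Y quadratic≡0 = begin
    ((L.1# L.+ L.1#) L.* (A L.- L.1#)) L.* (Y L.* Y)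
      ≡⟨ L.solve 2 (λ A Y → ((L.:1 L.:+ L.:1) L.:* (A L.:- L.:1)) L.:* (Y L.:* Y)
            L.:= A L.:* (L.:- Y L.:* L.:- Y) L.:+ (L.:- Y L.:* Y L.:+ L.:- Y L.:* Y) L.:+ A L.:* (Y L.:* Y)) refl A Y ⟩
    A L.* (L.- Y L.* L.- Y) L.+ (L.- Y L.* Y L.+ L.- Y L.* Y) L.+ A L.* (Y L.* Y)
      ≡⟨ cong (λ T → A L.* (T L.* T) L.+ (T L.* Y L.+ T L.* Y) L.+ A L.* (Y L.* Y)) σY≡-Y ⟨
    A L.* (σ Y L.* σ Y) L.+ (σ Y L.* Y L.+ σ Y L.* Y) L.+ A L.* (Y L.* Y)
      ≡⟨ quadratic≡0 ⟩
    L.0# ∎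

  -- With σ Y = κ Y and κ² = 1: κ = 1 puts Y, hence f Y, in F_q; κ = -1 forces 2 (a - 1) Y² = 0.
  no-preimage-pureRoot : ∀ {X c} → PureRoot X c → ∀ Y → ¬ f Y ≡ X
  no-preimage-pureRoot {X} X-pure Y fY≡X = proportional-absurd (quadratic⇒proportional (σ Y) Y quadratic)
    where
    fY∉K : ¬ InK (f Y)
    fY∉K = subst (λ Z → ¬ InK Z) (sym fY≡X) (PureRoot.∉K X-pure)
    quadratic : A L.* (σ Y L.* σ Y) L.+ (σ Y L.* Y L.+ σ Y L.* Y) L.+ A L.* (Y L.* Y) ≡ L.0#
    quadratic = anti-invariant-image Y (subst (λ Z → σ Z ≡ L.- Z) (sym fY≡X) (PureRoot.σ-anti X-pure))
    Y≢0 : ¬ Y ≡ L.0#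
    Y≢0 Y≡0 = fY∉K (fq K.0# , trans (sym (f-ι K.0#)) (cong f (trans ι-0 (sym Y≡0))))
    proportional-absurd : ¬ ∃ λ κ → σ Y ≡ ι κ L.* Y
    proportional-absurd (κ , σY≡κY) = [ κ≢1 , κ≢-1 ]′ (K.x*x≡1⇒x≡1⊎x≡-1 (σ-proportional⇒κ²≡1 Y≢0 σY≡κY))
      where
      σY≡ικ′Y : ∀ {κ′} → κ ≡ κ′ → σ Y ≡ ι κ′ L.* Y
      σY≡ικ′Y refl = σY≡κY
      κ≢1 : ¬ κ ≡ K.1#
      κ≢1 κ≡1 = fY∉K (fq (proj₁ Y∈K) , trans (sym (f-ι _)) (cong f (proj₂ Y∈K)))
        where
        Y∈K : InK Y
        Y∈K = σ-fixed⇒InK Y (trans (σY≡ικ′Y κ≡1) (trans (cong (L._* Y) ι-1) (L.*-identityˡ Y)))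
      κ≢-1 : ¬ κ ≡ K.- K.1#
      κ≢-1 κ≡-1 with L.x*y≡0⇒x≡0⊎y≡0 (conjugate-negated⇒[1+1][A-1]Y²≡0 Y σY≡-Y quadratic)
        where
        σY≡-Y : σ Y ≡ L.- Y
        σY≡-Y = trans (σY≡ικ′Y κ≡-1) (trans (cong (L._* Y) (trans (ι-neg K.1#) (cong L.-_ ι-1)))
                  (L.solve 1 (λ Y → L.:- L.:1 L.:* Y L.:= L.:- Y) refl Y))
      ... | inj₂ Y²≡0       = Y≢0 (L.x*x≡0⇒x≡0 Y²≡0)
      ... | inj₁ [1+1][A-1]≡0 with L.x*y≡0⇒x≡0⊎y≡0 [1+1][A-1]≡0
      ...   | inj₁ 1+1≡0 = 2≢0ᴸ 1+1≡0
      ...   | inj₂ A-1≡0 = a≢1 (ι-injective (trans (L.x-y≡0⇒x≡y _ _ A-1≡0) (sym ι-1)))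

  V : Set
  V = Attached-V K L E a

  next : V → V
  next = Attached-next K L E a

  Attachable : K.Carrier → Set
  Attachable α = K.χ₂ (α K.* (a K.- K.1#)) ≡ -[1+ 0 ]

  attached-≡ : ∀ {α β} {h : Attachable α} {h′ : Attachable β} {i j} → α ≡ β → i ≡ j →
               _≡_ {A = V} (inj₂ ((α , h) , i)) (inj₂ ((β , h′) , j))
  attached-≡ {h = h} {h′} refl refl = cong (λ h″ → inj₂ ((_ , h″) , _)) (Decidable⇒UIP.≡-irrelevant ℤ._≟_ h h′)

  -- an attached vertex above α squares to ι (α / (a - 1))
  radicand : K.Carrier → K.Carrier
  radicand α = α K.* K.inv (a K.- K.1#) a-1≢0

  [a-1]*radicand : ∀ α → (a K.- K.1#) K.* radicand α ≡ α
  [a-1]*radicand α = begin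
    (a K.- K.1#) K.* (α K.* K.inv (a K.- K.1#) a-1≢0) ≡⟨ K.solve 3 (λ b α i → b K.:* (α K.:* i) K.:= α K.:* (b K.:* i)) refl _ α _ ⟩
    α K.* ((a K.- K.1#) K.* K.inv (a K.- K.1#) a-1≢0) ≡⟨ cong (α K.*_) (K.*-inverseʳ _ a-1≢0) ⟩
    α K.* K.1#                                       ≡⟨ K.*-identityʳ α ⟩
    α                                                ∎

  α[a-1]≡[a-1]²*radicand : ∀ α → α K.* (a K.- K.1#) ≡ ((a K.- K.1#) K.* (a K.- K.1#)) K.* radicand α
  α[a-1]≡[a-1]²*radicand α = begin
    α K.* (a K.- K.1#)                                ≡⟨ cong (K._* (a K.- K.1#)) ([a-1]*radicand α) ⟨
    ((a K.- K.1#) K.* radicand α) K.* (a K.- K.1#)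
      ≡⟨ K.solve 2 (λ b c → (b K.:* c) K.:* b K.:= (b K.:* b) K.:* c) refl (a K.- K.1#) (radicand α) ⟩
    ((a K.- K.1#) K.* (a K.- K.1#)) K.* radicand α    ∎

  radicand-nonSquare : ∀ {α} → Attachable α → ¬ K.IsSquare (radicand α)
  radicand-nonSquare {α} h radicand-square = proj₂ (K.χ₂≡-1⇒nonSquare _ h)
    (subst K.IsSquare (sym (α[a-1]≡[a-1]²*radicand α)) (K.square-* (a K.- K.1# , refl) radicand-square))

  attachable : ∀ {c} → ¬ c ≡ K.0# → ¬ K.IsSquare c → Attachable ((a K.- K.1#) K.* c)
  attachable {c} c≢0 c-nonSquare = K.nonSquare⇒χ₂≡-1 _
    (subst (λ z → ¬ z ≡ K.0#) eq (K.*-≢0 (K.*-≢0 a-1≢0 a-1≢0) c≢0))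
    (subst (λ z → ¬ K.IsSquare z) eq (K.nonSquare-*-square a-1≢0 c-nonSquare))
    where
    eq : ((a K.- K.1#) K.* (a K.- K.1#)) K.* c ≡ ((a K.- K.1#) K.* c) K.* (a K.- K.1#)
    eq = K.solve 2 (λ b c → (b K.:* b) K.:* c K.:= (b K.:* c) K.:* b) refl (a K.- K.1#) c

  sqrt : K.Carrier → L.Carrier
  sqrt α = proj₁ (ι-square (radicand α))

  sqrt-square : ∀ α → sqrt α L.* sqrt α ≡ ι (radicand α)
  sqrt-square α = proj₂ (ι-square (radicand α))

  ±_ : Fin 2 → L.Carrier → L.Carrier
  (± zero)  W = W
  (± suc _) W = L.- W

  ±-square : ∀ i W → (± i) W L.* (± i) W ≡ W L.* W
  ±-square zero    W = refl
  ±-square (suc _) W = L.-x*-x≡x*x W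

  ψ : V → L.Carrier
  ψ (inj₁ x)             = ι x
  ψ (inj₂ ((α , _) , i)) = (± i) (sqrt α)

  ψ-pureRoot : ∀ α (h : Attachable α) i → PureRoot (ψ (inj₂ ((α , h) , i))) (radicand α)
  ψ-pureRoot α h i = pureRoot-nonSquare (trans (±-square i _) (sqrt-square α)) (radicand-nonSquare h)

  ψ-hom : ∀ v → ψ (next v) ≡ f (ψ v)
  ψ-hom (inj₁ x)             = sym (f-ι x)
  ψ-hom (inj₂ ((α , h) , i)) = sym (trans (f-pureRoot (ψ-pureRoot α h i)) (cong ι ([a-1]*radicand α)))

  ±-injective : ∀ {W} → ¬ W ≡ L.0# → ∀ i j → (± i) W ≡ (± j) W → i ≡ j
  ±-injective W≢0 zero       zero       _ = refl
  ±-injective W≢0 (suc zero) (suc zero) _ = refl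
  ±-injective W≢0 zero       (suc zero) e = contradiction e (L.x≢-x 2≢0ᴸ W≢0)
  ±-injective W≢0 (suc zero) zero       e = contradiction (sym e) (L.x≢-x 2≢0ᴸ W≢0)

  ψ-injective : Injective _≡_ _≡_ ψ
  ψ-injective {inj₁ x} {inj₁ y} ιx≡ιy = cong inj₁ (ι-injective ιx≡ιy)
  ψ-injective {inj₁ x} {inj₂ ((β , h) , j)} e = contradiction (x , e) (PureRoot.∉K (ψ-pureRoot β h j))
  ψ-injective {inj₂ ((α , h) , i)} {inj₁ y} e = contradiction (y , sym e) (PureRoot.∉K (ψ-pureRoot α h i))
  ψ-injective {inj₂ ((α , h) , i)} {inj₂ ((β , h′) , j)} e =
    attached-≡ α≡β (±-injective sqrt≢0 i j (trans e (cong (λ γ → (± j) (sqrt γ)) (sym α≡β))))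
    where
    α≡β : α ≡ β
    α≡β = trans (sym ([a-1]*radicand α)) (trans (cong ((a K.- K.1#) K.*_) (ι-injective (begin
      ι (radicand α)                    ≡⟨ PureRoot.square (ψ-pureRoot α h i) ⟨
      (± i) (sqrt α) L.* (± i) (sqrt α) ≡⟨ cong (λ w → w L.* w) e ⟩
      (± j) (sqrt β) L.* (± j) (sqrt β) ≡⟨ PureRoot.square (ψ-pureRoot β h′ j) ⟩
      ι (radicand β)                    ∎))) ([a-1]*radicand β))
    sqrt≢0 : ¬ sqrt α ≡ L.0#
    sqrt≢0 = pureRoot≢0 (ψ-pureRoot α h zero)

  Image : L.Carrier → Set
  Image x = ∃ λ v → ψ v ≡ x

  image-closed : ∀ x → Image (f x) → Image x
  image-closed x (inj₁ y , ιy≡fx) with preimage-ι x y (sym ιy≡fx)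
  ... | inj₁ (z , ιz≡x , _)           = inj₁ z , ιz≡x
  ... | inj₂ (c , x-pure , y≡[a-1]c) = inj₂ ((y , h) , proj₁ sign) , sym (proj₂ sign)
    where
    h : Attachable y
    h = subst Attachable (sym y≡[a-1]c) (attachable (PureRoot.c≢0 x-pure) (PureRoot.c-nonSquare x-pure))
    radicand-y≡c : radicand y ≡ c
    radicand-y≡c = K.*-cancelˡ a-1≢0 (trans ([a-1]*radicand y) y≡[a-1]c)
    sign : ∃ λ i → x ≡ (± i) (sqrt y)
    sign = [ (λ x≡W → zero , x≡W) , (λ x≡-W → suc zero , x≡-W) ]′
      (L.x*x≡y*y⇒x≡y⊎x≡-y (trans (PureRoot.square x-pure) (trans (cong ι (sym radicand-y≡c)) (sym (sqrt-square y)))))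
  image-closed x (inj₂ ((α , h) , i) , ψv≡fx) = contradiction (sym ψv≡fx) (no-preimage-pureRoot (ψ-pureRoot α h i) x)

  attached-iso : FunGraphIso V next f (InFqComponent K L E a)
  attached-iso = ψ , ψ-injective , (λ x → mk⇔ (to x) (from x)) , ψ-hom
    where
    to : ∀ x → InFqComponent K L E a x → Image x
    to x (y , m , n , fᵐx≡fⁿιy) = iter-reflects f Image image-closed m x
      (inj₁ (iter fq n y) , trans (iter-commute ι (sym ∘ f-ι) n y) (sym fᵐx≡fⁿιy))
    from : ∀ x → Image x → InFqComponent K L E a x
    from x (inj₁ y , ιy≡x)           = y , 0 , 0 , sym ιy≡x
    from x (inj₂ ((α , h) , i) , refl) = α , 1 , 0 , sym (ψ-hom (inj₂ ((α , h) , i)))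

  f-0 : f L.0# ≡ L.0#
  f-0 = trans (cong f (sym ι-0)) (trans (f-ι K.0#) (trans (cong ι fq-0) ι-0))
    where
    fq-0 : fq K.0# ≡ K.0#
    fq-0 = trans (cong ((a K.+ K.1#) K.*_) (K.zeroˡ _)) (K.zeroʳ _)

  preimage-0 : ∀ Y → f Y ≡ L.0# → Y ≡ L.0#
  preimage-0 Y fY≡0 with preimage-ι Y K.0# (trans fY≡0 (sym ι-0))
  ... | inj₁ (z , ιz≡Y , [a+1]z²≡0) = trans (sym ιz≡Y) (trans (cong ι z≡0) ι-0)
    where
    z≡0 : z ≡ K.0#
    z≡0 = [ (λ a+1≡0 → contradiction a+1≡0 a+1≢0) , K.x*x≡0⇒x≡0 ]′ (K.x*y≡0⇒x≡0⊎y≡0 [a+1]z²≡0)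
  ... | inj₂ (c , Y-pure , 0≡[a-1]c) = contradiction
    ([ (λ a-1≡0 → contradiction a-1≡0 a-1≢0) , (λ c≡0 → c≡0) ]′ (K.x*y≡0⇒x≡0⊎y≡0 (sym 0≡[a-1]c)))
    (PureRoot.c≢0 Y-pure)

  zero-component : ∀ x → SameComponent f x L.0# → x ≡ L.0#
  zero-component = component-fixed-⊆ f (_≡ L.0#) f-0 refl preimage-0

  module FixedPointComponent (s′ r : ℕ) (m≡2^s′*r : m ≡ 2 ℕ.^ s′ ℕ.* r) (r-odd : ¬ 2 ∣ r)
                             (b : K.Carrier) (b-fixed : (a K.+ K.1#) K.* b ≡ K.1#) where
    open SquareTower K m q≡1+2m s′ r m≡2^s′*r r-odd

    b≢0 : ¬ b ≡ K.0#
    b≢0 b≡0 = K.1≢0 (trans (sym b-fixed) (trans (cong ((a K.+ K.1#) K.*_) b≡0) (K.zeroʳ _)))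

    b⁻¹ : K.Carrier
    b⁻¹ = K.inv b b≢0

    b*y*b⁻¹≡y : ∀ y → (b K.* y) K.* b⁻¹ ≡ y
    b*y*b⁻¹≡y y = trans (K.solve 3 (λ b y i → (b K.:* y) K.:* i K.:= i K.:* (b K.:* y)) refl b y b⁻¹) (K.inv-*-cancelˡ b b≢0 y)

    fq≡⇒square : ∀ {z x} → fq z ≡ x → z K.* z ≡ b K.* x
    fq≡⇒square {z} {x} fqz≡x = begin
      z K.* z                                    ≡⟨ K.*-identityˡ _ ⟨
      K.1# K.* (z K.* z)                         ≡⟨ cong (K._* (z K.* z)) (trans (sym b-fixed) (K.*-comm _ _)) ⟩
      (b K.* (a K.+ K.1#)) K.* (z K.* z)         ≡⟨ K.*-assoc _ _ _ ⟩
      b K.* ((a K.+ K.1#) K.* (z K.* z))         ≡⟨ cong (λ w → b K.* ((a K.+ K.1#) K.* w)) (K.x^2≡x*x z) ⟨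
      b K.* fq z                                 ≡⟨ cong (b K.*_) fqz≡x ⟩
      b K.* x                                    ∎

    square⇒fq≡ : ∀ {z x} → z K.* z ≡ b K.* x → fq z ≡ x
    square⇒fq≡ {z} {x} z²≡bx = begin
      (a K.+ K.1#) K.* (z K.^ 2)                 ≡⟨ cong ((a K.+ K.1#) K.*_) (trans (K.x^2≡x*x z) z²≡bx) ⟩
      (a K.+ K.1#) K.* (b K.* x)                 ≡⟨ K.*-assoc _ _ _ ⟨
      ((a K.+ K.1#) K.* b) K.* x                 ≡⟨ cong (K._* x) b-fixed ⟩
      K.1# K.* x                                 ≡⟨ K.*-identityˡ x ⟩
      x                                          ∎

    next-b : next (inj₁ b) ≡ inj₁ b
    next-b = cong inj₁ (square⇒fq≡ refl)

    next-[-b] : next (inj₁ (K.- b)) ≡ inj₁ b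
    next-[-b] = cong inj₁ (square⇒fq≡ (K.-x*-x≡x*x b))

    b≢-b : ¬ b ≡ K.- b
    b≢-b = K.x≢-x 2≢0ᴷ b≢0

    inj₁-[-b]≢inj₁-b : _≢_ {A = V} (inj₁ (K.- b)) (inj₁ b)
    inj₁-[-b]≢inj₁-b -b≡b = b≢-b (sym (Sum.inj₁-injective -b≡b))

    next≢inj₂ : ∀ v w → ¬ next v ≡ inj₂ w
    next≢inj₂ (inj₁ _) w ()
    next≢inj₂ (inj₂ _) w ()

    next-preimage : ∀ v x → next v ≡ inj₁ x →
      (∃ λ z → v ≡ inj₁ z × z K.* z ≡ b K.* x) ⊎ (Σ (Attachable x) λ h → ∃ λ i → v ≡ inj₂ ((x , h) , i))
    next-preimage (inj₁ z)                x e    = inj₁ (z , refl , fq≡⇒square (Sum.inj₁-injective e))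
    next-preimage (inj₂ ((α , h) , i))    .α refl = inj₂ (h , i , refl)

    b[a-1]≡-[db]² : b K.* (a K.- K.1#) ≡ K.- ((d K.* b) K.* (d K.* b))
    b[a-1]≡-[db]² = sym (begin
      K.- ((d K.* b) K.* (d K.* b))
        ≡⟨ K.solve 2 (λ d b → K.:- ((d K.:* b) K.:* (d K.:* b)) K.:= K.:- ((d K.:* d) K.:* (b K.:* b))) refl d b ⟩
      K.- ((d K.* d) K.* (b K.* b))                  ≡⟨ cong (λ w → K.- (w K.* (b K.* b))) d*d≡1-a*a ⟩
      K.- ((K.1# K.- a K.* a) K.* (b K.* b))
        ≡⟨ K.solve 2 (λ a b → K.:- ((K.:1 K.:- a K.:* a) K.:* (b K.:* b)) K.:= (b K.:* (a K.:- K.:1)) K.:* ((a K.:+ K.:1) K.:* b)) refl a b ⟩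
      (b K.* (a K.- K.1#)) K.* ((a K.+ K.1#) K.* b)  ≡⟨ cong ((b K.* (a K.- K.1#)) K.*_) b-fixed ⟩
      (b K.* (a K.- K.1#)) K.* K.1#                  ≡⟨ K.*-identityʳ _ ⟩
      b K.* (a K.- K.1#)                             ∎)

    -b-not-attachable : ¬ Attachable (K.- b)
    -b-not-attachable h = proj₂ (K.χ₂≡-1⇒nonSquare _ h) (d K.* b , sym (begin
      (K.- b) K.* (a K.- K.1#)                   ≡⟨ K.solve 2 (λ b c → (K.:- b) K.:* c K.:= K.:- (b K.:* c)) refl b (a K.- K.1#) ⟩
      K.- (b K.* (a K.- K.1#))                   ≡⟨ cong K.-_ b[a-1]≡-[db]² ⟩
      K.- (K.- ((d K.* b) K.* (d K.* b)))        ≡⟨ K.solve 1 (λ x → K.:- (K.:- x) K.:= x) refl _ ⟩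
      (d K.* b) K.* (d K.* b)                    ∎))

    -1-root : (K.- K.1#) K.^ (2 ℕ.^ 0) ≡ K.- K.1#
    -1-root = K.*-identityʳ _

    -- The component of b is determined in the attached graph and carried to F_{q²} by ψ.
    component-⊆-image : ∀ x → SameComponent f x (ψ (inj₁ b)) → Image x
    component-⊆-image x x~ιb = Equivalence.to (proj₁ (proj₂ (proj₂ attached-iso)) x) (b , x~ιb)

    z*z≡b*x⇒[z/b]²≡x/b : ∀ {z x} → z K.* z ≡ b K.* x → (z K.* b⁻¹) K.* (z K.* b⁻¹) ≡ x K.* b⁻¹
    z*z≡b*x⇒[z/b]²≡x/b {z} {x} z²≡bx = begin
      (z K.* b⁻¹) K.* (z K.* b⁻¹)       ≡⟨ K.solve 2 (λ z i → (z K.:* i) K.:* (z K.:* i) K.:= (z K.:* z) K.:* (i K.:* i)) refl z b⁻¹ ⟩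
      (z K.* z) K.* (b⁻¹ K.* b⁻¹)       ≡⟨ cong (K._* (b⁻¹ K.* b⁻¹)) z²≡bx ⟩
      (b K.* x) K.* (b⁻¹ K.* b⁻¹)       ≡⟨ K.solve 3 (λ b x i → (b K.:* x) K.:* (i K.:* i) K.:= i K.:* (b K.:* (x K.:* i))) refl b x b⁻¹ ⟩
      b⁻¹ K.* (b K.* (x K.* b⁻¹))       ≡⟨ K.inv-*-cancelˡ b b≢0 _ ⟩
      x K.* b⁻¹                         ∎

    -b/b≡-1 : (K.- b) K.* b⁻¹ ≡ K.- K.1#
    -b/b≡-1 = trans (K.solve 2 (λ b i → (K.:- b) K.:* i K.:= K.:- (b K.:* i)) refl b b⁻¹) (cong K.-_ (K.*-inverseʳ b b≢0))

    module TwoAdicValuationOne (s′≡0 : s′ ≡ 0) where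

      -1-nonSquare : ¬ K.IsSquare (K.- K.1#)
      -1-nonSquare = tower-nonSquare 0 -1-root (sym s′≡0)

      b-attachable : Attachable b
      b-attachable = K.nonSquare⇒χ₂≡-1 _
        (subst (λ z → ¬ z ≡ K.0#) (sym b[a-1]≡) (K.*-≢0 (K.*-≢0 db≢0 db≢0) (K.-‿≢0 K.1≢0)))
        (subst (λ z → ¬ K.IsSquare z) (sym b[a-1]≡) (K.nonSquare-*-square db≢0 -1-nonSquare))
        where
        db≢0 : ¬ d K.* b ≡ K.0#
        db≢0 = K.*-≢0 d≢0 b≢0
        b[a-1]≡ : b K.* (a K.- K.1#) ≡ ((d K.* b) K.* (d K.* b)) K.* (K.- K.1#)
        b[a-1]≡ = trans b[a-1]≡-[db]² (K.solve 1 (λ x → K.:- x K.:= x K.:* (K.:- K.:1)) refl _)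

      leaf : Fin 3 → V
      leaf zero             = inj₁ (K.- b)
      leaf (suc zero)       = inj₂ ((b , b-attachable) , zero)
      leaf (suc (suc zero)) = inj₂ ((b , b-attachable) , suc zero)

      leaf-edge : ∀ i → next (leaf i) ≡ inj₁ b
      leaf-edge zero             = next-[-b]
      leaf-edge (suc zero)       = refl
      leaf-edge (suc (suc zero)) = refl

      leaf≢ρ : ∀ i → leaf i ≢ inj₁ b
      leaf≢ρ zero             = inj₁-[-b]≢inj₁-b
      leaf≢ρ (suc zero)       ()
      leaf≢ρ (suc (suc zero)) ()

      leaf-injective : Injective _≡_ _≡_ leaf
      leaf-injective {zero}           {zero}           _  = refl
      leaf-injective {zero}           {suc zero}       ()
      leaf-injective {zero}           {suc (suc zero)} ()
      leaf-injective {suc zero}       {zero}           ()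
      leaf-injective {suc zero}       {suc zero}       _  = refl
      leaf-injective {suc zero}       {suc (suc zero)} ()
      leaf-injective {suc (suc zero)} {zero}           ()
      leaf-injective {suc (suc zero)} {suc zero}       ()
      leaf-injective {suc (suc zero)} {suc (suc zero)} _  = refl

      preimage-ρ : ∀ v → next v ≡ inj₁ b → v ≡ inj₁ b ⊎ ∃ λ i → v ≡ leaf i
      preimage-ρ v e with next-preimage v b e
      ... | inj₁ (z , refl , z²≡b²) = [ (λ z≡b → inj₁ (cong inj₁ z≡b)) , (λ z≡-b → inj₂ (zero , cong inj₁ z≡-b)) ]′
                                        (K.x*x≡y*y⇒x≡y⊎x≡-y z²≡b²)
      ... | inj₂ (h , zero , refl)     = inj₂ (suc zero , attached-≡ refl refl)
      ... | inj₂ (h , suc zero , refl) = inj₂ (suc (suc zero) , attached-≡ refl refl)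

      no-preimage-leaf : ∀ i v → next v ≢ leaf i
      no-preimage-leaf zero v e with next-preimage v (K.- b) e
      ... | inj₁ (z , _ , z²≡-b²) = -1-nonSquare (z K.* b⁻¹ , trans (z*z≡b*x⇒[z/b]²≡x/b z²≡-b²) -b/b≡-1)
      ... | inj₂ (h , _)          = -b-not-attachable h
      no-preimage-leaf (suc zero)       v = next≢inj₂ v _
      no-preimage-leaf (suc (suc zero)) v = next≢inj₂ v _

      zstar4 : FunGraphIso Zstar4-V Zstar4-next f (λ x → SameComponent f x (ι b))
      zstar4 = FunGraphIso-embed ψ (inj₁ b) ψ-injective ψ-hom component-⊆-image
        (Zstar4Recognition.zstar4-iso next (inj₁ b) leaf next-b leaf-edge leaf≢ρ leaf-injective preimage-ρ no-preimage-leaf)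

    ±ᴷ : Bool → K.Carrier → K.Carrier
    ±ᴷ true  u = u
    ±ᴷ false u = K.- u

    bit : Bool → Fin 2
    bit true  = zero
    bit false = suc zero

    attachable? : ∀ x → Dec (Attachable x)
    attachable? x = K.χ₂ (x K.* (a K.- K.1#)) ℤ.≟ -[1+ 0 ]

    -- the two preimages of inj₁ x when x / b is a square or x is attachable; junk otherwise
    childOf : ∀ x → Dec (K.IsSquare (x K.* b⁻¹)) → Dec (Attachable x) → Bool → V
    childOf x (yes (u , _)) _       β = inj₁ (b K.* ±ᴷ β u)
    childOf x (no _)        (yes h) β = inj₂ ((x , h) , bit β)
    childOf x (no _)        (no _)  β = inj₁ x

    child : V → Bool → V
    child (inj₁ x) = childOf x (K.isSquare? (x K.* b⁻¹)) (attachable? x)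
    child (inj₂ w) = λ _ → inj₂ w

    child-square : ∀ x → K.IsSquare (x K.* b⁻¹) →
                   ∃ λ u → u K.* u ≡ x K.* b⁻¹ × (∀ β → child (inj₁ x) β ≡ inj₁ (b K.* ±ᴷ β u))
    child-square x x/b-square = go (K.isSquare? (x K.* b⁻¹)) (attachable? x)
      where
      go : ∀ s? h? → ∃ λ u → u K.* u ≡ x K.* b⁻¹ × (∀ β → childOf x s? h? β ≡ inj₁ (b K.* ±ᴷ β u))
      go (yes (u , u²≡x/b)) _ = u , u²≡x/b , λ _ → refl
      go (no x/b-nonSquare) _ = contradiction x/b-square x/b-nonSquare

    child-attached : ∀ x → ¬ K.IsSquare (x K.* b⁻¹) → (h : Attachable x) → ∀ β → child (inj₁ x) β ≡ inj₂ ((x , h) , bit β)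
    child-attached x x/b-nonSquare h β = go (K.isSquare? (x K.* b⁻¹)) (attachable? x)
      where
      go : ∀ s? h? → childOf x s? h? β ≡ inj₂ ((x , h) , bit β)
      go (yes x/b-square) _        = contradiction x/b-square x/b-nonSquare
      go (no _)           (yes h′) = attached-≡ refl refl
      go (no _)           (no ¬h)  = contradiction h ¬h


    x/b≡0⇒x≡0 : ∀ {x} → x K.* b⁻¹ ≡ K.0# → x ≡ K.0#
    x/b≡0⇒x≡0 {x} x/b≡0 = begin
      x                      ≡⟨ b*y*b⁻¹≡y x ⟨
      (b K.* x) K.* b⁻¹      ≡⟨ K.*-assoc b x b⁻¹ ⟩
      b K.* (x K.* b⁻¹)      ≡⟨ cong (b K.*_) x/b≡0 ⟩
      b K.* K.0#             ≡⟨ K.zeroʳ b ⟩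
      K.0#                   ∎

    [b*w]²≡b*x : ∀ {w x} → w K.* w ≡ x K.* b⁻¹ → (b K.* w) K.* (b K.* w) ≡ b K.* x
    [b*w]²≡b*x {w} {x} w²≡x/b = begin
      (b K.* w) K.* (b K.* w)          ≡⟨ K.solve 2 (λ b w → (b K.:* w) K.:* (b K.:* w) K.:= b K.:* (b K.:* (w K.:* w))) refl b w ⟩
      b K.* (b K.* (w K.* w))          ≡⟨ cong (λ z → b K.* (b K.* z)) w²≡x/b ⟩
      b K.* (b K.* (x K.* b⁻¹))        ≡⟨ cong (b K.*_) (K.solve 3 (λ b x i → b K.:* (x K.:* i) K.:= x K.:* (b K.:* i)) refl b x b⁻¹) ⟩
      b K.* (x K.* (b K.* b⁻¹))        ≡⟨ cong (λ z → b K.* (x K.* z)) (K.*-inverseʳ b b≢0) ⟩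
      b K.* (x K.* K.1#)               ≡⟨ cong (b K.*_) (K.*-identityʳ x) ⟩
      b K.* x                          ∎

    ±ᴷ-square : ∀ β u → ±ᴷ β u K.* ±ᴷ β u ≡ u K.* u
    ±ᴷ-square true  u = refl
    ±ᴷ-square false u = K.-x*-x≡x*x u

    twoChildren-square : K.IsSquare (b K.* (a K.- K.1#)) → ∀ {x} → ¬ x ≡ K.0# → K.IsSquare (x K.* b⁻¹) →
                         TwoChildren next child (inj₁ x)
    twoChildren-square b[a-1]-square {x} x≢0 x/b-square = record
      { child-edge        = λ β → trans (cong next (children β))
                                        (cong inj₁ (square⇒fq≡ ([b*w]²≡b*x (trans (±ᴷ-square β u) u²≡x/b))))
      ; children-distinct = λ e → K.x≢-x 2≢0ᴷ u≢0 (K.*-cancelˡ b≢0 (Sum.inj₁-injective (trans (sym (children true)) (trans e (children false)))))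
      ; preimage-child    = preimage-child }
      where
      u : K.Carrier
      u = proj₁ (child-square x x/b-square)
      u²≡x/b : u K.* u ≡ x K.* b⁻¹
      u²≡x/b = proj₁ (proj₂ (child-square x x/b-square))
      children : ∀ β → child (inj₁ x) β ≡ inj₁ (b K.* ±ᴷ β u)
      children = proj₂ (proj₂ (child-square x x/b-square))
      u≢0 : ¬ u ≡ K.0#
      u≢0 u≡0 = x≢0 (x/b≡0⇒x≡0 (trans (sym u²≡x/b) (trans (cong (K._* u) u≡0) (K.zeroˡ u))))
      preimage-child : ∀ v → next v ≡ inj₁ x → ∃ λ β → v ≡ child (inj₁ x) β
      preimage-child v e with next-preimage v x e
      ... | inj₁ (z , refl , z²≡bx) =
        [ (λ z≡bu → true , trans (cong inj₁ z≡bu) (sym (children true)))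
        , (λ z≡-bu → false , trans (cong inj₁ (trans z≡-bu (K.solve 2 (λ b u → K.:- (b K.:* u) K.:= b K.:* (K.:- u)) refl b u)))
                                   (sym (children false))) ]′
          (K.x*x≡y*y⇒x≡y⊎x≡-y (trans z²≡bx (sym ([b*w]²≡b*x u²≡x/b))))
      ... | inj₂ (h , _) = contradiction (subst K.IsSquare x[a-1]≡ (K.square-* x/b-square b[a-1]-square)) (proj₂ (K.χ₂≡-1⇒nonSquare _ h))
        where
        x[a-1]≡ : (x K.* b⁻¹) K.* (b K.* (a K.- K.1#)) ≡ x K.* (a K.- K.1#)
        x[a-1]≡ = trans (K.solve 4 (λ x i b c → (x K.:* i) K.:* (b K.:* c) K.:= x K.:* c K.:* (b K.:* i)) refl x b⁻¹ b (a K.- K.1#))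
                        (trans (cong (x K.* (a K.- K.1#) K.*_) (K.*-inverseʳ b b≢0)) (K.*-identityʳ _))

    twoChildren-attached : ∀ {x} → ¬ K.IsSquare (x K.* b⁻¹) → Attachable x → TwoChildren next child (inj₁ x)
    twoChildren-attached {x} x/b-nonSquare h = record
      { child-edge        = λ β → cong next (child-attached x x/b-nonSquare h β)
      ; children-distinct = λ e → bits-distinct (trans (sym (child-attached x x/b-nonSquare h true)) (trans e (child-attached x x/b-nonSquare h false)))
      ; preimage-child    = preimage-child }
      where
      bits-distinct : ¬ _≡_ {A = V} (inj₂ ((x , h) , zero)) (inj₂ ((x , h) , suc zero))
      bits-distinct ()
      preimage-child : ∀ v → next v ≡ inj₁ x → ∃ λ β → v ≡ child (inj₁ x) β
      preimage-child v e with next-preimage v x e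
      ... | inj₁ (z , _ , z²≡bx)     = contradiction (z K.* b⁻¹ , z*z≡b*x⇒[z/b]²≡x/b z²≡bx) x/b-nonSquare
      ... | inj₂ (h′ , zero , refl)     = true  , trans (attached-≡ refl refl) (sym (child-attached x x/b-nonSquare h true))
      ... | inj₂ (h′ , suc zero , refl) = false , trans (attached-≡ refl refl) (sym (child-attached x x/b-nonSquare h false))

    module TwoAdicValuationAtLeastTwo (t : ℕ) (s′≡1+t : s′ ≡ suc t) where

      -1-square : K.IsSquare (K.- K.1#)
      -1-square = tower-square 0 -1-root (subst (0 <_) (sym s′≡1+t) (ℕ.s≤s ℕ.z≤n))

      i : K.Carrier
      i = proj₁ -1-square

      g : K.Carrier
      g = (d K.* b) K.* i

      g≢0 : ¬ g ≡ K.0#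
      g≢0 = K.*-≢0 (K.*-≢0 d≢0 b≢0) i≢0
        where
        i≢0 : ¬ i ≡ K.0#
        i≢0 i≡0 = K.-‿≢0 K.1≢0 (trans (sym (proj₂ -1-square)) (trans (cong (K._* i) i≡0) (K.zeroˡ i)))

      b[a-1]≡g² : b K.* (a K.- K.1#) ≡ g K.* g
      b[a-1]≡g² = begin
        b K.* (a K.- K.1#)                     ≡⟨ b[a-1]≡-[db]² ⟩
        K.- ((d K.* b) K.* (d K.* b))          ≡⟨ K.solve 2 (λ x i → K.:- x K.:= x K.:* (K.:- K.:1)) refl _ i ⟩
        ((d K.* b) K.* (d K.* b)) K.* K.- K.1# ≡⟨ cong (((d K.* b) K.* (d K.* b)) K.*_) (proj₂ -1-square) ⟨
        ((d K.* b) K.* (d K.* b)) K.* (i K.* i) ≡⟨ K.solve 2 (λ x i → (x K.:* x) K.:* (i K.:* i) K.:= (x K.:* i) K.:* (x K.:* i)) refl (d K.* b) i ⟩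
        g K.* g                                ∎

      b-not-attachable : ¬ Attachable b
      b-not-attachable h = proj₂ (K.χ₂≡-1⇒nonSquare _ h) (g , sym b[a-1]≡g²)

      attachable-b* : ∀ {y} → ¬ y ≡ K.0# → ¬ K.IsSquare y → Attachable (b K.* y)
      attachable-b* {y} y≢0 y-nonSquare = K.nonSquare⇒χ₂≡-1 _
        (subst (λ z → ¬ z ≡ K.0#) by[a-1]≡ (K.*-≢0 (K.*-≢0 g≢0 g≢0) y≢0))
        (subst (λ z → ¬ K.IsSquare z) by[a-1]≡ (K.nonSquare-*-square g≢0 y-nonSquare))
        where
        by[a-1]≡ : (g K.* g) K.* y ≡ (b K.* y) K.* (a K.- K.1#)
        by[a-1]≡ = trans (cong (K._* y) (sym b[a-1]≡g²)) (K.solve 3 (λ b c y → (b K.:* c) K.:* y K.:= (b K.:* y) K.:* c) refl b (a K.- K.1#) y)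

      preimage-b : ∀ v → next v ≡ inj₁ b → v ≡ inj₁ b ⊎ v ≡ inj₁ (K.- b)
      preimage-b v e with next-preimage v b e
      ... | inj₁ (z , refl , z²≡b²) = [ (λ z≡b → inj₁ (cong inj₁ z≡b)) , (λ z≡-b → inj₂ (cong inj₁ z≡-b)) ]′
                                        (K.x*x≡y*y⇒x≡y⊎x≡-y z²≡b²)
      ... | inj₂ (h , _)            = contradiction h b-not-attachable

      depth : ℕ
      depth = suc s′ ℕ.+ 1

      module Tree = CycTreeRecognition next (inj₁ b) (inj₁ (K.- b)) child depth (ℕ.m≤n+m 1 (suc s′))
                      next-b next-[-b] inj₁-[-b]≢inj₁-b preimage-b

      -- Address l carries b y with y ^ (2 ^ length l) = -1.  By the square tower, y is a square
      -- while length l < s′, and then the children are b (± √y); at length s′ they are attached.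
      Level : List Bool → Set
      Level l = ∃ λ y → Tree.vertex l ≡ inj₁ (b K.* y) × y K.^ (2 ℕ.^ length l) ≡ K.- K.1#

      level : ∀ l → length l ≤ s′ → Level l
      level []      _      = K.- K.1# , cong inj₁ (K.solve 1 (λ b → K.:- b K.:= b K.:* (K.:- K.:1)) refl b) , -1-root
      level (β ∷ l) 1+l≤s′ = step (level l (ℕ.<⇒≤ 1+l≤s′))
        where
        step : Level l → Level (β ∷ l)
        step (y , vl≡by , y^2^l≡-1) = ±ᴷ β u , trans (cong (λ v → child v β) vl≡by) (children β) , (begin
          ±ᴷ β u K.^ (2 ℕ.* 2 ℕ.^ length l)      ≡⟨ K.^-*-assoc (±ᴷ β u) 2 (2 ℕ.^ length l) ⟨
          (±ᴷ β u K.^ 2) K.^ (2 ℕ.^ length l)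
            ≡⟨ cong (K._^ (2 ℕ.^ length l)) (trans (K.x^2≡x*x _) (trans (±ᴷ-square β u) (trans u²≡y (b*y*b⁻¹≡y y)))) ⟩
          y K.^ (2 ℕ.^ length l)                 ≡⟨ y^2^l≡-1 ⟩
          K.- K.1#                               ∎)
          where
          by/b-square : K.IsSquare ((b K.* y) K.* b⁻¹)
          by/b-square = subst K.IsSquare (sym (b*y*b⁻¹≡y y)) (tower-square (length l) y^2^l≡-1 1+l≤s′)
          u : K.Carrier
          u = proj₁ (child-square (b K.* y) by/b-square)
          u²≡y : u K.* u ≡ (b K.* y) K.* b⁻¹
          u²≡y = proj₁ (proj₂ (child-square (b K.* y) by/b-square))
          children : ∀ β → child (inj₁ (b K.* y)) β ≡ inj₁ (b K.* ±ᴷ β u)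
          children = proj₂ (proj₂ (child-square (b K.* y) by/b-square))

      <depth⇒≤s′ : ∀ {j} → suc j < depth → j ≤ s′
      <depth⇒≤s′ {j} 2+j≤depth = ℕ.≤-pred (ℕ.≤-pred (subst (suc (suc j) ≤_) (ℕ.+-comm (suc s′) 1) 2+j≤depth))

      level-nonSquare : ∀ l → length l ≡ s′ → ∃ λ y → Tree.vertex l ≡ inj₁ (b K.* y) × ¬ y ≡ K.0# × ¬ K.IsSquare y
      level-nonSquare l l≡s′ = nonSquare (level l (ℕ.≤-reflexive l≡s′))
        where
        nonSquare : Level l → ∃ λ y → Tree.vertex l ≡ inj₁ (b K.* y) × ¬ y ≡ K.0# × ¬ K.IsSquare y
        nonSquare (y , vl≡by , y^2^l≡-1) = y , vl≡by , y^2^j≡-1⇒y≢0 (length l) y^2^l≡-1 , tower-nonSquare (length l) y^2^l≡-1 l≡s′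
      by/b-nonSquare : ∀ {y} → ¬ K.IsSquare y → ¬ K.IsSquare ((b K.* y) K.* b⁻¹)
      by/b-nonSquare {y} = subst (λ z → ¬ K.IsSquare z) (sym (b*y*b⁻¹≡y y))

      inner : ∀ l → suc (length l) < depth → TwoChildren next child (Tree.vertex l)
      inner l 2+l≤depth = byDepth (length l ℕ.<? s′)
        where
        squareCase : length l < s′ → Level l → TwoChildren next child (Tree.vertex l)
        squareCase l<s′ (y , vl≡by , y^2^l≡-1) = subst (TwoChildren next child) (sym vl≡by)
          (twoChildren-square (g , sym b[a-1]≡g²) (K.*-≢0 b≢0 (y^2^j≡-1⇒y≢0 (length l) y^2^l≡-1))
            (subst K.IsSquare (sym (b*y*b⁻¹≡y y)) (tower-square (length l) y^2^l≡-1 l<s′)))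
        lastCase : (∃ λ y → Tree.vertex l ≡ inj₁ (b K.* y) × ¬ y ≡ K.0# × ¬ K.IsSquare y) → TwoChildren next child (Tree.vertex l)
        lastCase (y , vl≡by , y≢0 , y-nonSquare) = subst (TwoChildren next child) (sym vl≡by)
          (twoChildren-attached (by/b-nonSquare y-nonSquare) (attachable-b* y≢0 y-nonSquare))
        byDepth : Dec (length l < s′) → TwoChildren next child (Tree.vertex l)
        byDepth (yes l<s′) = squareCase l<s′ (level l (<depth⇒≤s′ 2+l≤depth))
        byDepth (no l≮s′)  = lastCase (level-nonSquare l (ℕ.≤-antisym (<depth⇒≤s′ 2+l≤depth) (ℕ.≮⇒≥ l≮s′)))

      leaf : ∀ l → suc (length l) ≡ depth → ∀ v → next v ≢ Tree.vertex l
      leaf []      1≡depth   _ = contradiction (ℕ.suc-injective (trans 1≡depth (ℕ.+-comm (suc s′) 1))) (λ ())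
      leaf (β ∷ l) 2+l≡depth v = attachedCase (level-nonSquare l (ℕ.suc-injective (ℕ.suc-injective (trans 2+l≡depth (ℕ.+-comm (suc s′) 1)))))
        where
        attachedCase : (∃ λ y → Tree.vertex l ≡ inj₁ (b K.* y) × ¬ y ≡ K.0# × ¬ K.IsSquare y) → next v ≢ child (Tree.vertex l) β
        attachedCase (y , vl≡by , y≢0 , y-nonSquare) = subst (λ w → next v ≢ child w β) (sym vl≡by)
          (subst (next v ≢_) (sym (child-attached (b K.* y) (by/b-nonSquare y-nonSquare) (attachable-b* y≢0 y-nonSquare) β)) (next≢inj₂ v _))

      cycTree : FunGraphIso (CycTree-V depth) (CycTree-next depth) f (λ x → SameComponent f x (ι b))
      cycTree = FunGraphIso-embed ψ (inj₁ b) ψ-injective ψ-hom component-⊆-image (Tree.cycTree-iso inner leaf)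

    fixedPoint-component :
      f (ι b) ≡ ι b
      × (suc s′ ≡ 1 → FunGraphIso Zstar4-V Zstar4-next f (λ x → SameComponent f x (ι b)))
      × (2 ≤ suc s′ → FunGraphIso (CycTree-V (suc s′ ℕ.+ 1)) (CycTree-next (suc s′ ℕ.+ 1)) f (λ x → SameComponent f x (ι b)))
    fixedPoint-component = trans (f-ι b) (cong ι (square⇒fq≡ refl))
                         , (λ 1+s′≡1 → TwoAdicValuationOne.zstar4 (ℕ.suc-injective 1+s′≡1))
                         , (λ 2≤1+s′ → TwoAdicValuationAtLeastTwo.cycTree (ℕ.pred s′)
                                         (sym (ℕ.suc-pred s′ {{ℕ.>-nonZero (ℕ.≤-pred 2≤1+s′)}})))

open import Data.Nat using (_+_; _*_; _∸_; _^_)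
open import Data.Integer using (+_)

theorem4p2 :
    (q : ℕ) → (∃ λ p → ∃ λ k → Prime p × ¬ (p ≡ 2) × 1 ≤ k × q ≡ p ^ k) →
    (s r : ℕ) → q ∸ 1 ≡ 2 ^ s * r → ¬ (2 ∣ r) →
    (K : FiniteField q) (L : FiniteField (q * q)) (E : FieldEmbedding K L) →
    (a : FiniteField.Carrier K) →
    ¬ (a ≡ FiniteField.0# K) → ¬ (a ≡ FiniteField.1# K) →
    ¬ (a ≡ FiniteField.-_ K (FiniteField.1# K)) →
    FiniteField.χ₂ K (FiniteField._-_ K (FiniteField.1# K) (FiniteField._^_ K a 2)) ≡ + 1 →
    -- f restricted to F_q is x ↦ (a+1) x^2
    (∀ x → f-map K L E a (FieldEmbedding.ι E x) ≡ FieldEmbedding.ι E (fq-map K L E a x))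
    -- the union of components meeting F_q is isomorphic to the attached graph
    × FunGraphIso (Attached-V K L E a) (Attached-next K L E a) (f-map K L E a) (InFqComponent K L E a)
    -- 0 is a fixed point whose component is {0}
    × (f-map K L E a (FiniteField.0# L) ≡ FiniteField.0# L
       × (∀ x → SameComponent (f-map K L E a) x (FiniteField.0# L) → x ≡ FiniteField.0# L))
    -- 1/(a+1) is a fixed point with the described component
    × (∀ b → FiniteField._*_ K (FiniteField._+_ K a (FiniteField.1# K)) b ≡ FiniteField.1# K →
         f-map K L E a (FieldEmbedding.ι E b) ≡ FieldEmbedding.ι E b
         × (s ≡ 1 → FunGraphIso Zstar4-V Zstar4-next (f-map K L E a)
                      (λ x → SameComponent (f-map K L E a) x (FieldEmbedding.ι E b)))
         × (2 ≤ s → FunGraphIso (CycTree-V (s + 1)) (CycTree-next (s + 1)) (f-map K L E a)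
                      (λ x → SameComponent (f-map K L E a) x (FieldEmbedding.ι E b))))
theorem4p2 q (p , k , p-prime , p≢2 , _ , q≡p^k) s r q-1≡2^s*r r-odd K L E a a≢0 a≢1 a≢-1 χ[1-a²]≡1
  with ¬2∣⇒≡1+2* q (subst (λ n → ¬ 2 ∣ n) (sym q≡p^k) (¬2∣^ k (¬2∣odd-prime p-prime p≢2)))
... | m , q≡1+2m with 2*m≡2^s*r⇒s≡1+s′ {m} s r (trans (cong (_∸ 1) (sym q≡1+2m)) q-1≡2^s*r) r-odd
... | s′ , refl , m≡2^s′*r = f-ι , attached-iso , (f-0 , zero-component) ,
  FixedPointComponent.fixedPoint-component s′ r m≡2^s′*r r-odd
  where open Dynamics {k = k} p-prime q≡p^k K L E m q≡1+2m a a≢0 a≢1 a≢-1 χ[1-a²]≡1
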